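{- Let $F$ be a forest with vertex set $X$ and let $\overline F$ be its edge ideal. Then $\overline F$ is simple, and (i) if $\overline F$ is conical, then $R(\overline F)$ collapses onto a point; (ii) if $\overline F$ is spherical, then $R(\overline F)$ collapses onto (a subcomplex isomorphic to) the boundary of a cross-polytope of dimension $d(\overline F)$.
   Context: For a graph $G=(V,E)$ with $V=X=\{x_1,\ldots,x_n\}$, the edge ideal $\overline G\subset\mathbb{Z}[X]$ is generated by $x_1^2,\ldots,x_n^2$ and $x_ix_j$ for $\{x_i,x_j\}\in E$; $R(\overline G)$, the set of monomials not in $\overline G$ (i.e. independent sets), is the independence complex. In general, for a monomial ideal $I$ containing all $x_i^2$, $R(I)$ is the simplicial complex of monomials not in $I$; $(I:x)=\{m:xm\in I\}$; $R(I)$ is a cone with apex $a$ if $(I:a)=(I,a)$; $a$ dominates $b$ in $I$ if $R(I)$ is not a cone with apex $b$ but $R((I,a))$ is a cone with apex $b$. For a sequence $A=(a_1,\ldots,a_r)$ of variables put $I_i=(I:a_1\cdots a_{i-1})$; $A$ is a resolution if for all $i\in[r]$, $a_i\notin I_i$ and either $R(I_i)$ is a cone with apex $a_i$ or $a_i$ dominates some $b_i$ in $I_i$. Maximal resolutions are those that cannot be extended; core $c(A)=I_{r+1}$, depth $d(A)=r$; $c(I)$ is the set of cores of maximal resolutions and $d(I)$ the minimal depth of a maximal resolution. $A$ is spherical if no $R(I_i)$, $i\in[r]$, is a cone with apex $a_i$. $I$ is spherical if it has a spherical maximal resolution, conical if it has a non-spherical resolution, and simple if the ideal $(x_1,\ldots,x_n)$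 lies in $c(I)$ (ideals in $\mathbb{Z}[X]$ are identified with their extensions $(I,a)$ by extra variables $a$). An elementary collapse removes a maximal face $\sigma$ and a face $\tau\subset\sigma$ with $\deg\tau=\deg\sigma-1$ such that $\sigma$ is the only face properly containing $\tau$; collapsing means a sequence of these. The boundary of the $d$-dimensional cross-polytope is $R\bigl((y_1y_2,y_3y_4,\ldots,y_{2d-1}y_{2d},y_1^2,\ldots,y_{2d}^2)\bigr)$ (for $d=0$ this is $\{1\}$). -}

module Defs where

open import Data.Nat using (ℕ; zero; suc; _+_; _≤_)
open import Data.Fin using (Fin; zero; suc; inject₁; fromℕ)
open import Data.Fin.Properties using (_≟_)
open import Data.Bool using (Bool; true; false; T)
open import Data.List using (List; []; _∷_; _++_; [_]; length)
open import Data.Product using (Σ; ∃; ∃-syntax; _×_; _,_)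
open import Data.Sum using (_⊎_)
open import Data.Unit using (⊤)
open import Relation.Nullary using (¬_; yes; no)
open import Relation.Binary.PropositionalEquality using (_≡_; _≢_)
open import Relation.Binary.Construct.Closure.ReflexiveTransitive using (Star)
open import Function.Definitions using (Injective)

Monomial : ℕ → Set
Monomial n = Fin n → ℕ

one : ∀ {n} → Monomial n
one _ = 0

var : ∀ {n} → Fin n → Monomial n
var a i with i ≟ a
... | yes _ = 1
... | no  _ = 0

_·_ : ∀ {n} → Monomial n → Monomial n → Monomial n
(m · m') i = m i + m' i

_∣ₘ_ : ∀ {n} → Monomial n → Monomial n → Set
m ∣ₘ m' = ∀ i → m i ≤ m' i

_≈ₘ_ : ∀ {n} → Monomial n → Monomial n → Set
m ≈ₘ m' = ∀ i → m i ≡ m' i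

deg : ∀ {n} → Monomial n → ℕ
deg {zero}  m = 0
deg {suc n} m = m zero + deg (λ i → m (suc i))

-- Monomial ideals of ℤ[X], identified with the set of monomials they
-- contain (a monomial ideal is determined by its monomials).

Ideal : ℕ → Set₁
Ideal n = Monomial n → Set

_≐_ : ∀ {n} → Ideal n → Ideal n → Set
I ≐ J = ∀ m → (I m → J m) × (J m → I m)

_,,_ : ∀ {n} → Ideal n → Fin n → Ideal n
(I ,, a) m = I m ⊎ (var a ∣ₘ m)

_∶_ : ∀ {n} → Ideal n → Monomial n → Ideal n
(I ∶ u) m = I (u · m)

maxIdeal : ∀ {n} → Ideal n
maxIdeal m = ∃[ i ] (1 ≤ m i)

record Graph (n : ℕ) : Set where
  field
    Adj   : Fin n → Fin n → Bool
    sym   : ∀ i j → Adj i j ≡ Adj j i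
    irrefl : ∀ i → Adj i i ≡ false

open Graph public

-- a cycle of length k+3 ≥ 3: distinct vertices c_0 … c_{k+2} with
-- c_j adjacent to c_{j+1} and c_{k+2} adjacent to c_0
record Cycle {n : ℕ} (G : Graph n) : Set where
  field
    k     : ℕ
    c     : Fin (suc (suc (suc k))) → Fin n
    inj   : Injective _≡_ _≡_ c
    steps : ∀ (j : Fin (suc (suc k))) → T (Adj G (c (inject₁ j)) (c (suc j)))
    close : T (Adj G (c (fromℕ (suc (suc k)))) (c zero))

IsForest : ∀ {n} → Graph n → Set
IsForest G = ¬ Cycle G

edgeIdeal : ∀ {n} → Graph n → Ideal n
edgeIdeal G m =
  (∃[ i ] (2 ≤ m i)) ⊎ (∃[ i ] ∃[ j ] (T (Adj G i j) × 1 ≤ m i × 1 ≤ m j))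

-- R(I) is a cone with apex a :  (I : a) = (I , a)
IsCone : ∀ {n} → Ideal n → Fin n → Set
IsCone I a = (I ∶ var a) ≐ (I ,, a)

Dominates : ∀ {n} → Ideal n → Fin n → Fin n → Set
Dominates I a b = ¬ IsCone I b × IsCone (I ,, a) b

-- I_{r+1} = (I : a_1 ⋯ a_r), computed iteratively
-- ((I : a_1 ⋯ a_i) = ((I : a_1 ⋯ a_{i-1}) : a_i))
coreOf : ∀ {n} → Ideal n → List (Fin n) → Ideal n
coreOf I []      = I
coreOf I (a ∷ A) = coreOf (I ∶ var a) A

IsResolution : ∀ {n} → Ideal n → List (Fin n) → Set
IsResolution I []      = ⊤
IsResolution I (a ∷ A) =
  ¬ I (var a) × (IsCone I a ⊎ ∃[ b ] Dominates I a b) × IsResolution (I ∶ var a) A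

IsSphericalSeq : ∀ {n} → Ideal n → List (Fin n) → Set
IsSphericalSeq I []      = ⊤
IsSphericalSeq I (a ∷ A) = ¬ IsCone I a × IsSphericalSeq (I ∶ var a) A

IsMaximalResolution : ∀ {n} → Ideal n → List (Fin n) → Set
IsMaximalResolution I A =
  IsResolution I A × (∀ a → ¬ IsResolution I (A ++ [ a ]))

IsSpherical : ∀ {n} → Ideal n → Set
IsSpherical I = ∃[ A ] (IsMaximalResolution I A × IsSphericalSeq I A)

IsConical : ∀ {n} → Ideal n → Set
IsConical I = ∃[ A ] (IsResolution I A × ¬ IsSphericalSeq I A)

IsSimple : ∀ {n} → Ideal n → Set
IsSimple I = ∃[ A ] (IsMaximalResolution I A × coreOf I A ≐ maxIdeal)

IsMinDepth : ∀ {n} → Ideal n → ℕ → Set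
IsMinDepth I d =
  (∃[ A ] (IsMaximalResolution I A × length A ≡ d))
  × (∀ A → IsMaximalResolution I A → d ≤ length A)

-- Simplicial complexes (sets of monomials) and collapses

Complex : ℕ → Set₁
Complex n = Monomial n → Set

R : ∀ {n} → Ideal n → Complex n
R I m = ¬ I m

record ElemCollapse {n : ℕ} (K K' : Complex n) : Set where
  field
    σ τ       : Monomial n
    σ∈K       : K σ
    τ∈K       : K τ
    τ∣σ       : τ ∣ₘ σ
    degτσ     : deg τ + 1 ≡ deg σ
    σ-maximal : ∀ ρ → K ρ → σ ∣ₘ ρ → ρ ≈ₘ σ
    τ-free    : ∀ ρ → K ρ → τ ∣ₘ ρ → ¬ (ρ ≈ₘ τ) → ρ ≈ₘ σ
    result    : ∀ ρ → (K' ρ → K ρ × ¬ (ρ ≈ₘ σ) × ¬ (ρ ≈ₘ τ))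
                    × (K ρ × ¬ (ρ ≈ₘ σ) × ¬ (ρ ≈ₘ τ) → K' ρ)

Collapses : ∀ {n} → Complex n → Complex n → Set₁
Collapses = Star ElemCollapse

IsPoint : ∀ {n} → Complex n → Set
IsPoint K = ∃[ v ] (∀ m → (K m → m ≈ₘ one ⊎ m ≈ₘ var v)
                        × (m ≈ₘ one ⊎ m ≈ₘ var v → K m))

-- the ideal (y_{i,false} y_{i,true} (i < d), y_v² (all v)) in the 2d
-- variables y_v, v ∈ Fin d × Bool; its R is the boundary of the
-- d-dimensional cross-polytope
crossIdeal : (d : ℕ) → (Fin d × Bool → ℕ) → Set
crossIdeal d m =
  (∃[ v ] (2 ≤ m v)) ⊎ (∃[ i ] (1 ≤ m (i , false) × 1 ≤ m (i , true)))

-- K is isomorphic to the boundary of the d-dimensional cross-polytope: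
-- via an injective vertex map f, the faces of K are exactly the images
-- of the faces of R(crossIdeal d)
IsCrossPolytopeBoundary : ∀ {n} → Complex n → ℕ → Set
IsCrossPolytopeBoundary {n} K d =
  Σ (Fin d × Bool → Fin n) λ f →
    Injective _≡_ _≡_ f ×
    (∀ m → (K m → ((∀ i → (∀ v → f v ≢ i) → m i ≡ 0) × ¬ crossIdeal d (λ v → m (f v))))
         × (((∀ i → (∀ v → f v ≢ i) → m i ≡ 0) × ¬ crossIdeal d (λ v → m (f v))) → K m))

{-# OPTIONS --safe #-}

-- Every ideal met along a resolution of Ḡ is Ḡ + (x_i : i ∉ W) for a set W of vertices. A cone step at
-- a means that a is isolated in F[W], a domination step that a is the neighbour of a leaf b of F[W], and
-- both replace W by W ∖ N[a]. A forest always has an isolated vertex or a leaf, so it can be pruned down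
-- to the empty set; this is simplicity. Along the pruning, Ind(F[U]) is collapsed step by step: at a
-- leaf step the other neighbours c of a can be deleted one by one, since N(b) = {a} ⊆ N(c), after which
-- ab is a separate edge; at an isolated step everything but a can be deleted, leaving a point. A spherical
-- pruning thus ends with d disjoint edges, whose independence complex is the boundary of the
-- d-dimensional cross-polytope. Finally, deleting a or N[a] splits the independent sets of F, so their
-- number is even when some maximal resolution is conical and odd when one is spherical.

module Submission where

open import Defs hiding (sym)

open import Data.Bool using (Bool; true; false; not; if_then_else_; T)
open import Data.Bool.Properties using (T-≡)
open import Data.Empty using (⊥; ⊥-elim)
open import Data.Fin using (Fin; zero; suc; toℕ; inject₁; fromℕ)
open import Data.Fin.Properties
  using (_≟_; any?; all?; ¬∀⟶∃¬; suc-injective; pigeonhole; toℕ-injective; toℕ<n; toℕ-fromℕ; toℕ-inject₁)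
open import Data.Fin.Subset
  using (Subset; inside; outside; _∈_; _∉_; _⊆_; _⊂_; _─_; _-_; ⁅_⁆; Empty)
  renaming (⊤ to full)
open import Data.Fin.Subset.Induction using (⊂-wellFounded)
open import Data.Fin.Subset.Properties
  using (anySubset?; nonempty?; _∈?_; _⊆?_; drop-there; drop-∷-Empty; x∉⁅y⁆⇒x≢y; x∈⁅x⁆; x∈⁅y⁆⇒x≡y;
         ⊆-antisym; p─q⊆p; x∈p∧x∉q⇒x∈p─q; x∈p∧x≢y⇒x∈p-y; x∈p⇒p-x⊂p; ∈⊤)
open import Data.List using (List; []; _∷_; _++_; [_]; length)
open import Data.Nat using (ℕ; zero; suc; _+_; _*_; _∸_; _≤_; _<_; z≤n; s≤s; _<ᵇ_)
open import Data.Nat.Divisibility using (_∣_; divides; m∣m*n; ∣m∣n⇒∣m+n; ∣m+n∣m⇒∣n)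
open import Data.Nat.Induction using (<-wellFounded)
open import Data.Nat.Properties
  using (≤-refl; ≤-trans; ≤-pred; ≤-reflexive; ≤-antisym; <-irrefl; <-cmp; _≤?_; ≰⇒>; n<1⇒n≡0; n<1+n;
         n≤1⇒n≡0∨n≡1; m≤m+n; m≤n+m; m∸n≤m; m≤n⇒∃[o]m+o≡n; +-comm; +-identityʳ; +-suc; +-mono-≤;
         +-monoˡ-≤; +-monoʳ-≤; +-monoʳ-<; +-mono-<-≤; +-mono-≤-<; anyUpTo?; +-commutativeSemigroup)
import Data.Nat.Properties
open import Algebra.Properties.CommutativeSemigroup +-commutativeSemigroup using (interchange)
open import Data.Product using (Σ; ∃; ∃-syntax; _×_; _,_; proj₁; proj₂)
import Data.Product
open import Data.Sum using (_⊎_; inj₁; inj₂; [_,_]′)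
import Data.Sum
open import Data.Unit using (⊤; tt)
open import Data.Vec using ([]; _∷_; lookup; tabulate; _[_]%=_; here; there)
open import Data.Vec.Properties
  using (lookup∘tabulate; []=⇒lookup; lookup⇒[]=; lookup∘updateAt; lookup∘updateAt′)
open import Function using (_∘_; id; _⇔_; mk⇔; Equivalence; Injective)
open import Induction.WellFounded using (Acc; acc)
open import Level using (Level)
open import Relation.Binary using (tri<; tri≈; tri>)
open import Relation.Binary.Construct.Closure.ReflexiveTransitive using (ε; _◅_; _◅◅_)
open import Relation.Binary.PropositionalEquality
  using (_≡_; _≢_; refl; sym; trans; cong; cong₂; subst; subst₂; module ≡-Reasoning)
open import Relation.Nullary using (¬_; Dec; yes; no; contradiction; ¬?)
open import Relation.Nullary.Decidable
  using (_×-dec_; _⊎-dec_; _→-dec_; isYes; toWitness; fromWitness; T?; decidable-stable)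
open import Relation.Unary using (Pred; Decidable)

private
  variable
    ℓ : Level
    n : ℕ
    a b c i j v : Fin n
    m m' m'' : Monomial n
    S U U' W D : Subset n
    I I' I'' : Ideal n
    A B : List (Fin n)

SquareFree : Monomial n → Set
SquareFree m = ∀ i → m i ≤ 1

var-diag : (a : Fin n) → var a a ≡ 1
var-diag a with a ≟ a
... | yes _   = refl
... | no  a≢a = contradiction refl a≢a

var-off : i ≢ a → var a i ≡ 0
var-off {i = i} {a = a} i≢a with i ≟ a
... | yes i≡a = contradiction i≡a i≢a
... | no  _   = refl

var-cases : (a i : Fin n) → (i ≡ a × var a i ≡ 1) ⊎ (i ≢ a × var a i ≡ 0)
var-cases a i with i ≟ a
... | yes refl = inj₁ (refl , refl)
... | no  i≢a  = inj₂ (i≢a , refl)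

var-squareFree : (a : Fin n) → SquareFree (var a)
var-squareFree a i with var-cases a i
... | inj₁ (_ , e) = ≤-reflexive e
... | inj₂ (_ , e) = subst (_≤ 1) (sym e) z≤n

var-support : 1 ≤ var a i → i ≡ a
var-support {a = a} {i = i} 1≤ with var-cases a i
... | inj₁ (i≡a , _) = i≡a
... | inj₂ (_ , e)   = contradiction (subst (1 ≤_) e 1≤) λ ()

var-∣ : 1 ≤ m a → var a ∣ₘ m
var-∣ {a = a} 1≤ i with var-cases a i
... | inj₁ (refl , e) = subst (_≤ _) (sym e) 1≤
... | inj₂ (_ , e)    = subst (_≤ _) (sym e) z≤n

≈ₘ-sym : m ≈ₘ m' → m' ≈ₘ m
≈ₘ-sym e i = sym (e i)

≈ₘ-trans : m ≈ₘ m' → m' ≈ₘ m'' → m ≈ₘ m''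
≈ₘ-trans e e' i = trans (e i) (e' i)

≈ₘ⇒∣ₘ : m ≈ₘ m' → m ∣ₘ m'
≈ₘ⇒∣ₘ e i = ≤-reflexive (e i)

_≈ₘ?_ : (m m' : Monomial n) → Dec (m ≈ₘ m')
m ≈ₘ? m' = all? (λ i → m i Data.Nat.Properties.≟ m' i)

∣ₘ-· : (m m' : Monomial n) → m ∣ₘ (m · m')
∣ₘ-· m m' i = m≤m+n (m i) (m' i)

squareFree-∣ₘ : SquareFree m → m' ∣ₘ m → SquareFree m'
squareFree-∣ₘ sf d i = ≤-trans (d i) (sf i)

deg-cong : {m m' : Monomial n} → m ≈ₘ m' → deg m ≡ deg m'
deg-cong {n = zero}  e = refl
deg-cong {n = suc n} e = cong₂ _+_ (e zero) (deg-cong (e ∘ suc))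

deg-· : (m m' : Monomial n) → deg (m · m') ≡ deg m + deg m'
deg-· {n = zero}  m m' = refl
deg-· {n = suc n} m m' = begin
  m zero + m' zero + deg ((m ∘ suc) · (m' ∘ suc))
    ≡⟨ cong (m zero + m' zero +_) (deg-· (m ∘ suc) (m' ∘ suc)) ⟩
  m zero + m' zero + (deg (m ∘ suc) + deg (m' ∘ suc))
    ≡⟨ interchange (m zero) (m' zero) _ _ ⟩
  deg m + deg m' ∎
  where open ≡-Reasoning

deg-one : deg (one {n}) ≡ 0
deg-one {n = zero}  = refl
deg-one {n = suc n} = deg-one {n}

var-suc : (a i : Fin n) → var (suc a) (suc i) ≡ var a i
var-suc a i with var-cases a i
... | inj₁ (refl , e) = trans (var-diag (suc a)) (sym e)
... | inj₂ (i≢a , e)  = trans (var-off (i≢a ∘ suc-injective)) (sym e)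

deg-var : (a : Fin n) → deg (var a) ≡ 1
deg-var {n = suc n} zero =
  cong₂ _+_ (var-diag (zero {n})) (trans (deg-cong {n = n} {m' = one} var-zero-suc) (deg-one {n}))
  where
  var-zero-suc : ∀ i → var zero (suc i) ≡ 0
  var-zero-suc i = var-off {i = suc i} {a = zero} λ ()
deg-var {n = suc n} (suc a) =
  cong₂ _+_ (var-off {i = zero} {a = suc a} λ ()) (trans (deg-cong (var-suc a)) (deg-var a))

deg-·var : (m : Monomial n) (a : Fin n) → deg (m · var a) ≡ suc (deg m)
deg-·var m a = trans (deg-· m (var a)) (trans (cong (deg m +_) (deg-var a)) (+-comm (deg m) 1))

deg-squareFree : {m : Monomial n} → SquareFree m → deg m ≤ n
deg-squareFree {zero}  sf = z≤n
deg-squareFree {suc n} sf = +-mono-≤ (sf zero) (deg-squareFree (sf ∘ suc))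

toggle : Fin n → Monomial n → Monomial n
toggle v m i with i ≟ v
... | yes _ = 1 ∸ m i
... | no  _ = m i

toggle-diag : (v : Fin n) (m : Monomial n) → toggle v m v ≡ 1 ∸ m v
toggle-diag v m with v ≟ v
... | yes _   = refl
... | no  v≢v = contradiction refl v≢v

toggle-off : i ≢ v → toggle v m i ≡ m i
toggle-off {i = i} {v = v} i≢v with i ≟ v
... | yes i≡v = contradiction i≡v i≢v
... | no  _   = refl

toggle-cases : (v i : Fin n) (m : Monomial n) →
               (i ≡ v × toggle v m i ≡ 1 ∸ m i) ⊎ (i ≢ v × toggle v m i ≡ m i)
toggle-cases v i m with i ≟ v
... | yes refl = inj₁ (refl , refl)
... | no  i≢v  = inj₂ (i≢v , refl)

toggle-squareFree : (v : Fin n) → SquareFree m → SquareFree (toggle v m)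
toggle-squareFree {m = m} v sf i with toggle-cases v i m
... | inj₁ (_ , e) = subst (_≤ 1) (sym e) (m∸n≤m 1 (m i))
... | inj₂ (_ , e) = subst (_≤ 1) (sym e) (sf i)

toggle-cong : (v : Fin n) → m ≈ₘ m' → toggle v m ≈ₘ toggle v m'
toggle-cong {m = m} {m' = m'} v e i with toggle-cases v i m | toggle-cases v i m'
... | inj₁ (_ , t) | inj₁ (_ , t') = trans t (trans (cong (1 ∸_) (e i)) (sym t'))
... | inj₂ (_ , t) | inj₂ (_ , t') = trans t (trans (e i) (sym t'))
... | inj₁ (i≡v , _) | inj₂ (i≢v , _) = contradiction i≡v i≢v
... | inj₂ (i≢v , _) | inj₁ (i≡v , _) = contradiction i≡v i≢v

toggle-involutive : (v : Fin n) → SquareFree m → toggle v (toggle v m) ≈ₘ m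
toggle-involutive {m = m} v sf i with toggle-cases v i (toggle v m) | toggle-cases v i m
... | inj₁ (_ , t) | inj₁ (_ , t') rewrite t | t' with m i | sf i
...   | zero     | _ = refl
...   | suc zero | _ = refl
...   | suc (suc _) | s≤s ()
toggle-involutive v sf i | inj₂ (_ , t) | inj₂ (_ , t') = trans t t'
toggle-involutive v sf i | inj₁ (i≡v , _) | inj₂ (i≢v , _) = contradiction i≡v i≢v
toggle-involutive v sf i | inj₂ (i≢v , _) | inj₁ (i≡v , _) = contradiction i≡v i≢v

toggle-absent : m v ≡ 0 → toggle v m ≈ₘ (m · var v)
toggle-absent {m = m} {v = v} mv≡0 i with toggle-cases v i m
... | inj₁ (refl , t) = trans t (trans (cong (1 ∸_) mv≡0) (sym (cong₂ _+_ mv≡0 (var-diag v))))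
... | inj₂ (i≢v , t)  = trans t (sym (trans (cong (m i +_) (var-off i≢v)) (+-identityʳ (m i))))

toggle-present : m v ≡ 1 → m ≈ₘ (toggle v m · var v)
toggle-present {m = m} {v = v} mv≡1 i with toggle-cases v i m
... | inj₁ (refl , t) = trans mv≡1 (sym (cong₂ _+_ (trans t (cong (1 ∸_) mv≡1)) (var-diag v)))
... | inj₂ (i≢v , t)  = sym (trans (cong₂ _+_ t (var-off i≢v)) (+-identityʳ (m i)))

toggle-support : (v : Fin n) (m : Monomial n) (i : Fin n) → 1 ≤ toggle v m i → i ≡ v ⊎ 1 ≤ m i
toggle-support v m i 1≤ with toggle-cases v i m
... | inj₁ (i≡v , _) = inj₁ i≡v
... | inj₂ (_ , e)   = inj₂ (subst (1 ≤_) e 1≤)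

∣ₘ-·ʳ : (m'' : Monomial n) → m ∣ₘ m' → (m · m'') ∣ₘ (m' · m'')
∣ₘ-·ʳ m'' d i = +-monoˡ-≤ (m'' i) (d i)

·var-∣ₘ : m ∣ₘ m' → m a ≡ 0 → 1 ≤ m' a → (m · var a) ∣ₘ m'
·var-∣ₘ {m = m} {m' = m'} {a = a} d ma≡0 1≤m'a i with var-cases a i
... | inj₁ (refl , e) = subst (_≤ m' i) (sym (cong₂ _+_ ma≡0 e)) 1≤m'a
... | inj₂ (_ , e)    = subst (_≤ m' i) (sym (trans (cong (m i +_) e) (+-identityʳ (m i)))) (d i)

squareFree-gap : ∀ {x y} → x ≤ y → y ≤ 1 → x ≢ y → x ≡ 0 × y ≡ 1
squareFree-gap z≤n       z≤n       x≢y = contradiction refl x≢y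
squareFree-gap z≤n       (s≤s z≤n) _   = refl , refl
squareFree-gap (s≤s z≤n) (s≤s z≤n) x≢y = contradiction refl x≢y

toggle-swap : (v : Fin n) → SquareFree m → toggle v m ≈ₘ m' → m ≈ₘ toggle v m'
toggle-swap v sf e = ≈ₘ-trans (≈ₘ-sym (toggle-involutive v sf)) (toggle-cong v e)

⟦_⟧ : Subset n → Monomial n
⟦ S ⟧ i = if lookup S i then 1 else 0

support : Monomial n → Subset n
support m = tabulate (λ i → 0 <ᵇ m i)

⟦support⟧ : SquareFree m → ⟦ support m ⟧ ≈ₘ m
⟦support⟧ {m = m} sf i rewrite lookup∘tabulate (λ i → 0 <ᵇ m i) i with m i | sf i
... | zero        | _      = refl
... | suc zero    | _      = refl
... | suc (suc _) | s≤s ()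

∑ : (Subset n → ℕ) → ℕ
∑ {n = zero}  f = f []
∑ {n = suc n} f = ∑ (f ∘ (outside ∷_)) + ∑ (f ∘ (inside ∷_))

∑-mono : {f g : Subset n → ℕ} → (∀ S → f S ≤ g S) → ∑ f ≤ ∑ g
∑-mono {n = zero}  f≤g = f≤g []
∑-mono {n = suc n} f≤g = +-mono-≤ (∑-mono (f≤g ∘ (outside ∷_))) (∑-mono (f≤g ∘ (inside ∷_)))

∑-strict : {f g : Subset n → ℕ} → (∀ S → f S ≤ g S) → ∀ S₀ → f S₀ < g S₀ → ∑ f < ∑ g
∑-strict {n = zero}  f≤g [] f<g = f<g
∑-strict {n = suc n} f≤g (outside ∷ S₀) f<g =
  +-mono-<-≤ (∑-strict (f≤g ∘ (outside ∷_)) S₀ f<g) (∑-mono (f≤g ∘ (inside ∷_)))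
∑-strict {n = suc n} f≤g (inside ∷ S₀) f<g =
  +-mono-≤-< (∑-mono (f≤g ∘ (outside ∷_))) (∑-strict (f≤g ∘ (inside ∷_)) S₀ f<g)

∑-cong : {f g : Subset n → ℕ} → (∀ S → f S ≡ g S) → ∑ f ≡ ∑ g
∑-cong f≡g = ≤-antisym (∑-mono (≤-reflexive ∘ f≡g)) (∑-mono (≤-reflexive ∘ sym ∘ f≡g))

∑-+ : (f g : Subset n → ℕ) → ∑ (λ S → f S + g S) ≡ ∑ f + ∑ g
∑-+ {n = zero}  f g = refl
∑-+ {n = suc n} f g =
  trans (cong₂ _+_ (∑-+ (f ∘ (outside ∷_)) (g ∘ (outside ∷_)))
                   (∑-+ (f ∘ (inside ∷_))  (g ∘ (inside ∷_))))
        (interchange (∑ (f ∘ (outside ∷_))) (∑ (g ∘ (outside ∷_)))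
                     (∑ (f ∘ (inside ∷_)))  (∑ (g ∘ (inside ∷_))))

∑-flip : (v : Fin n) (f : Subset n → ℕ) → ∑ f ≡ ∑ (λ S → f (S [ v ]%= not))
∑-flip {n = suc n} zero    f = +-comm (∑ (f ∘ (outside ∷_))) (∑ (f ∘ (inside ∷_)))
∑-flip {n = suc n} (suc v) f = cong₂ _+_ (∑-flip v (f ∘ (outside ∷_))) (∑-flip v (f ∘ (inside ∷_)))

∑-zero : ∑ {n} (λ _ → 0) ≡ 0
∑-zero {n = zero}  = refl
∑-zero {n = suc n} = cong₂ _+_ (∑-zero {n}) (∑-zero {n})

indicator : {A : Set ℓ} → Dec A → ℕ
indicator (yes _) = 1
indicator (no  _) = 0

count : {P : Pred (Subset n) ℓ} → Decidable P → ℕ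
count P? = ∑ (indicator ∘ P?)

indicator-mono : {A B : Set ℓ} → (A → B) → (A? : Dec A) (B? : Dec B) → indicator A? ≤ indicator B?
indicator-mono A⇒B (yes a) (no ¬b) = contradiction (A⇒B a) ¬b
indicator-mono A⇒B (yes _) (yes _) = ≤-refl
indicator-mono A⇒B (no  _) _       = z≤n

module _ {P Q : Pred (Subset n) ℓ} (P? : Decidable P) (Q? : Decidable Q) where

  count-mono : (∀ {S} → P S → Q S) → count P? ≤ count Q?
  count-mono P⇒Q = ∑-mono λ S → indicator-mono P⇒Q (P? S) (Q? S)

  count-strict : (∀ {S} → P S → Q S) → ∀ S₀ → Q S₀ → ¬ P S₀ → count P? < count Q?
  count-strict P⇒Q S₀ q₀ ¬p₀ = ∑-strict (λ S → indicator-mono P⇒Q (P? S) (Q? S)) S₀ strict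
    where
    strict : indicator (P? S₀) < indicator (Q? S₀)
    strict with P? S₀ | Q? S₀
    ... | yes p | _     = contradiction p ¬p₀
    ... | no  _ | yes _ = s≤s z≤n
    ... | no  _ | no ¬q = contradiction q₀ ¬q

count-cong : {P Q : Pred (Subset n) ℓ} (P? : Decidable P) (Q? : Decidable Q) →
             (∀ {S} → P S ⇔ Q S) → count P? ≡ count Q?
count-cong P? Q? P⇔Q =
  ≤-antisym (count-mono P? Q? (Equivalence.to P⇔Q)) (count-mono Q? P? (Equivalence.from P⇔Q))

count-split : {P R : Pred (Subset n) ℓ} (P? : Decidable P) (R? : Decidable R) →
              count P? ≡ count (λ S → P? S ×-dec ¬? (R? S)) + count (λ S → P? S ×-dec R? S)
count-split P? R? =
  trans (∑-cong pointwise)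
        (∑-+ (λ S → indicator (P? S ×-dec ¬? (R? S))) (λ S → indicator (P? S ×-dec R? S)))
  where
  pointwise : ∀ S → indicator (P? S) ≡ indicator (P? S ×-dec ¬? (R? S)) + indicator (P? S ×-dec R? S)
  pointwise S with P? S | R? S
  ... | yes _ | yes _ = refl
  ... | yes _ | no  _ = refl
  ... | no  _ | _     = refl

count-none : {P : Pred (Subset n) ℓ} (P? : Decidable P) → (∀ S → ¬ P S) → count P? ≡ 0
count-none {n = n} P? ¬P = trans (∑-cong pointwise) (∑-zero {n})
  where
  pointwise : ∀ S → indicator (P? S) ≡ 0
  pointwise S with P? S
  ... | yes p = contradiction p (¬P S)
  ... | no  _ = refl

count-onlyEmpty : {P : Pred (Subset n) ℓ} (P? : Decidable P) →
                  (∀ {S} → P S ⇔ Empty S) → count P? ≡ 1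
count-onlyEmpty {n = zero} P? P⇔Empty with P? []
... | yes _ = refl
... | no ¬P = contradiction (Equivalence.from P⇔Empty λ { (() , _) }) ¬P
count-onlyEmpty {n = suc n} P? P⇔Empty =
  cong₂ _+_ (count-onlyEmpty (P? ∘ (outside ∷_)) (mk⇔ (drop-∷-Empty ∘ to) (from ∘ empty-∷)))
            (count-none (P? ∘ (inside ∷_)) λ S p → to p (zero , here))
  where
  to   = λ {S} → Equivalence.to (P⇔Empty {S})
  from = λ {S} → Equivalence.from (P⇔Empty {S})
  empty-∷ : ∀ {S} → Empty S → Empty (outside ∷ S)
  empty-∷ empty (suc i , there i∈S) = empty (i , i∈S)

least-witness : {P : Pred ℕ ℓ} → Decidable P → ∀ {k} → P k →
                ∃[ j ] (P j × ∀ {i} → i < j → ¬ P i)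
least-witness {P = P} P? = go (<-wellFounded _)
  where
  go : ∀ {k} → Acc _<_ k → P k → ∃[ j ] (P j × ∀ {i} → i < j → ¬ P i)
  go {k} (acc rec) pk with anyUpTo? P? k
  ... | yes (i , i<k , pi) = go (rec i<k) pi
  ... | no  none           = k , pk , λ i<k pi → none (_ , i<k , pi)

record IsComplex (K : Complex n) : Set where
  field
    squareFree : ∀ {m} → K m → SquareFree m
    downward   : ∀ {m m'} → K m → m' ∣ₘ m → K m'
    decidable  : ∀ m → Dec (K m)

  ≈-closed : K m → m ≈ₘ m' → K m'
  ≈-closed Km e = downward Km (≈ₘ⇒∣ₘ (≈ₘ-sym e))

Maximal : Complex n → Monomial n → Set
Maximal K s = ∀ u → ¬ K (s · var u)

ToggleClosed : Fin n → Complex n → Complex n → Set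
ToggleClosed v K L = ∀ {m} → K m → ¬ L m → K (toggle v m) × ¬ L (toggle v m)

_∖[_,_] : Complex n → Monomial n → Monomial n → Complex n
(K ∖[ σ , τ ]) ρ = K ρ × ¬ ρ ≈ₘ σ × ¬ ρ ≈ₘ τ

#extraFaces : {K L : Complex n} → IsComplex K → IsComplex L → ℕ
#extraFaces K-cx L-cx = count λ S → K.decidable ⟦ S ⟧ ×-dec ¬? (L.decidable ⟦ S ⟧)
  where
  module K = IsComplex K-cx
  module L = IsComplex L-cx

-- If toggling v preserves K ∖ L, then K collapses onto L: remove a maximal face σ of K ∖ L
-- together with σ ∖ v, and repeat.
module ToggleCollapse {K L : Complex n} (K-cx : IsComplex K) (L-cx : IsComplex L)
                      (L⊆K : ∀ {m} → L m → K m) (closed : ToggleClosed v K L) where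
  private
    module K = IsComplex K-cx
    module L = IsComplex L-cx

  extend-to-maximal : K m → ¬ L m → ∃[ s ] K s × ¬ L s × Maximal K s
  extend-to-maximal {m = m} = go n (m≤n+m n (deg m))
    where
    go : ∀ k {m} → n ≤ deg m + k → K m → ¬ L m → ∃[ s ] K s × ¬ L s × Maximal K s
    go k {m} bound Km ¬Lm with any? (λ u → K.decidable (m · var u))
    ... | no none = m , Km , ¬Lm , λ u Kmu → none (u , Kmu)
    go zero {m} bound Km ¬Lm | yes (u , Kmu) =
      contradiction (≤-trans (subst (_≤ n) (deg-·var m u) (deg-squareFree (K.squareFree Kmu)))
                             (subst (n ≤_) (+-identityʳ (deg m)) bound))
                    (<-irrefl refl)
    go (suc k) {m} bound Km ¬Lm | yes (u , Kmu) =
      go k (subst (n ≤_) (trans (+-suc (deg m) k) (cong (_+ k) (sym (deg-·var m u)))) bound)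
         Kmu (λ Lmu → ¬Lm (L.downward Lmu (∣ₘ-· m (var u))))

  CollapsesBelow : Set₁
  CollapsesBelow = ∀ {K'} (K'-cx : IsComplex K') → #extraFaces K'-cx L-cx < #extraFaces K-cx L-cx →
                   (∀ {m} → L m → K' m) → ToggleClosed v K' L →
                   ∀ {m} → K' m → ¬ L m → Collapses K' L

  module MaximalFace {s} (Ks : K s) (¬Ls : ¬ L s) (s-max : Maximal K s) where

    private
      s-sf = K.squareFree Ks

    s∋v : s v ≡ 1
    s∋v with n≤1⇒n≡0∨n≡1 (s-sf v)
    ... | inj₁ sv≡0 = contradiction (K.≈-closed (proj₁ (closed Ks ¬Ls)) (toggle-absent sv≡0)) (s-max v)
    ... | inj₂ sv≡1 = sv≡1

    t : Monomial n
    t = toggle v s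

    Kt : K t
    Kt = proj₁ (closed Ks ¬Ls)

    ¬Lt : ¬ L t
    ¬Lt = proj₂ (closed Ks ¬Ls)

    t∣s : t ∣ₘ s
    t∣s i = ≤-trans (∣ₘ-· t (var v) i) (≤-reflexive (sym (toggle-present s∋v i)))

    s-maximal : ∀ ρ → K ρ → s ∣ₘ ρ → ρ ≈ₘ s
    s-maximal ρ Kρ s∣ρ i with n≤1⇒n≡0∨n≡1 (K.squareFree Kρ i) | n≤1⇒n≡0∨n≡1 (s-sf i)
    ... | inj₁ ρi≡0 | inj₁ si≡0 = trans ρi≡0 (sym si≡0)
    ... | inj₂ ρi≡1 | inj₂ si≡1 = trans ρi≡1 (sym si≡1)
    ... | inj₁ ρi≡0 | inj₂ si≡1 = contradiction (subst₂ _≤_ si≡1 ρi≡0 (s∣ρ i)) λ ()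
    ... | inj₂ ρi≡1 | inj₁ si≡0 =
      contradiction (K.downward Kρ (·var-∣ₘ s∣ρ si≡0 (≤-reflexive (sym ρi≡1)))) (s-max i)

    -- If ρ ⊋ t misses v, some x_u divides ρ but not t, and then s · x_u divides ρ · x_v ∈ K.
    t-free : ∀ ρ → K ρ → t ∣ₘ ρ → ¬ ρ ≈ₘ t → ρ ≈ₘ s
    t-free ρ Kρ t∣ρ ρ≉t with n≤1⇒n≡0∨n≡1 (K.squareFree Kρ v)
    ... | inj₂ ρv≡1 = s-maximal ρ Kρ s∣ρ
      where
      s∣ρ : s ∣ₘ ρ
      s∣ρ i with toggle-cases v i s
      ... | inj₁ (refl , _) = subst (_≤ ρ i) (sym s∋v) (≤-reflexive (sym ρv≡1))
      ... | inj₂ (_ , e)    = subst (_≤ ρ i) e (t∣ρ i)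
    ... | inj₁ ρv≡0 = contradiction (K.downward Kρv (·var-∣ₘ s∣ρv su≡0 1≤ρvu)) (s-max u)
      where
      Kρv : K (ρ · var v)
      Kρv = K.≈-closed (proj₁ (closed Kρ λ Lρ → ¬Lt (L.downward Lρ t∣ρ))) (toggle-absent ρv≡0)
      gap = ¬∀⟶∃¬ n (λ i → ρ i ≡ t i) (λ i → ρ i Data.Nat.Properties.≟ t i) ρ≉t
      u = proj₁ gap
      tu≡0×ρu≡1 = squareFree-gap (t∣ρ u) (K.squareFree Kρ u) (proj₂ gap ∘ sym)
      tv≡0 : t v ≡ 0
      tv≡0 = trans (toggle-diag v s) (cong (1 ∸_) s∋v)
      u≢v : u ≢ v
      u≢v u≡v = proj₂ gap (subst (λ w → ρ w ≡ t w) (sym u≡v) (trans ρv≡0 (sym tv≡0)))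
      su≡0 : s u ≡ 0
      su≡0 = trans (sym (toggle-off u≢v)) (proj₁ tu≡0×ρu≡1)
      1≤ρvu : 1 ≤ (ρ · var v) u
      1≤ρvu = ≤-trans (≤-reflexive (sym (proj₂ tu≡0×ρu≡1))) (∣ₘ-· ρ (var v) u)
      s∣ρv : s ∣ₘ (ρ · var v)
      s∣ρv i = ≤-trans (≤-reflexive (toggle-present s∋v i)) (∣ₘ-·ʳ (var v) t∣ρ i)

    K' : Complex n
    K' = K ∖[ s , t ]

    collapse : (L' : Complex n) → (∀ {ρ} → L' ρ → K' ρ) → (∀ {ρ} → K' ρ → L' ρ) →
               ElemCollapse K L'
    collapse L' L'⊆K' K'⊆L' = record
      { σ = s ; τ = t ; σ∈K = Ks ; τ∈K = Kt ; τ∣σ = t∣s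
      ; degτσ = trans (+-comm (deg t) 1)
                      (sym (trans (deg-cong {n = n} {m = s} (toggle-present s∋v)) (deg-·var t v)))
      ; σ-maximal = s-maximal ; τ-free = t-free
      ; result = λ ρ → L'⊆K' , K'⊆L' }

    K'-isComplex : IsComplex K'
    K'-isComplex = record
      { squareFree = K.squareFree ∘ proj₁
      ; downward = λ { (Kρ , ρ≉s , ρ≉t) ρ'∣ρ →
          K.downward Kρ ρ'∣ρ
          , (λ ρ'≈s → ρ≉s (s-maximal _ Kρ λ i → subst (_≤ _) (ρ'≈s i) (ρ'∣ρ i)))
          , (λ ρ'≈t → ρ≉s (t-free _ Kρ (λ i → subst (_≤ _) (ρ'≈t i) (ρ'∣ρ i)) ρ≉t)) }
      ; decidable = λ ρ → K.decidable ρ ×-dec ¬? (ρ ≈ₘ? s) ×-dec ¬? (ρ ≈ₘ? t) }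

    private
      module K' = IsComplex K'-isComplex

    L⊆K' : ∀ {ρ} → L ρ → K' ρ
    L⊆K' Lρ = L⊆K Lρ , (λ ρ≈s → ¬Ls (L.≈-closed Lρ ρ≈s)) , (λ ρ≈t → ¬Lt (L.≈-closed Lρ ρ≈t))

    K'-closed : ToggleClosed v K' L
    K'-closed (Kρ , ρ≉s , ρ≉t) ¬Lρ =
      ( proj₁ (closed Kρ ¬Lρ)
      , (λ e → ρ≉t (toggle-swap v (K.squareFree Kρ) e))
      , (λ e → ρ≉s (≈ₘ-trans (toggle-swap v (K.squareFree Kρ) e) (toggle-involutive v s-sf))) )
      , proj₂ (closed Kρ ¬Lρ)

    #extraFaces-decreases : #extraFaces K'-isComplex L-cx < #extraFaces K-cx L-cx
    #extraFaces-decreases = count-strict _ _ (λ (K'S , ¬LS) → proj₁ K'S , ¬LS) (support s)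
      (K.≈-closed Ks (≈ₘ-sym ⟦s⟧≈s) , λ L⟦s⟧ → ¬Ls (L.≈-closed L⟦s⟧ ⟦s⟧≈s))
      (λ (K'⟦s⟧ , _) → proj₁ (proj₂ K'⟦s⟧) ⟦s⟧≈s)
      where ⟦s⟧≈s = ⟦support⟧ s-sf

    collapses-from : CollapsesBelow → Collapses K L
    collapses-from ih with anySubset? (λ S → K'.decidable ⟦ S ⟧ ×-dec ¬? (L.decidable ⟦ S ⟧))
    ... | yes (S , K'S , ¬LS) =
      collapse K' id id ◅ ih K'-isComplex #extraFaces-decreases L⊆K' K'-closed K'S ¬LS
    ... | no none = collapse L L⊆K' K'⊆L ◅ ε
      where
      K'⊆L : ∀ {ρ} → K' ρ → L ρ
      K'⊆L {ρ} K'ρ with L.decidable ρ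
      ... | yes Lρ = Lρ
      ... | no ¬Lρ = contradiction
        (support ρ , K'.≈-closed K'ρ (≈ₘ-sym ⟦ρ⟧≈ρ) , λ L⟦ρ⟧ → ¬Lρ (L.≈-closed L⟦ρ⟧ ⟦ρ⟧≈ρ)) none
        where ⟦ρ⟧≈ρ = ⟦support⟧ (K.squareFree (proj₁ K'ρ))

  collapses : CollapsesBelow → K m → ¬ L m → Collapses K L
  collapses ih Km ¬Lm with extend-to-maximal Km ¬Lm
  ... | _ , Ks , ¬Ls , s-max = MaximalFace.collapses-from Ks ¬Ls s-max ih


collapses-byToggle : {K L : Complex n} → IsComplex K → IsComplex L → (∀ {m} → L m → K m) →
                     ToggleClosed v K L → K m → ¬ L m → Collapses K L
collapses-byToggle {v = v} {L = L} K-cx L-cx L⊆K closed = go K-cx (<-wellFounded _) L⊆K closed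
  where
  go : ∀ {K} (K-cx : IsComplex K) → Acc _<_ (#extraFaces K-cx L-cx) →
       (∀ {m} → L m → K m) → ToggleClosed v K L → ∀ {m} → K m → ¬ L m → Collapses K L
  go K-cx (acc rec) L⊆K closed =
    ToggleCollapse.collapses K-cx L-cx L⊆K closed λ K'-cx lt → go K'-cx (rec lt)

ElemCollapse-respˡ : {K K' L : Complex n} → K ≐ K' → ElemCollapse K' L → ElemCollapse K L
ElemCollapse-respˡ K≐K' e = record
  { σ = σ ; τ = τ ; σ∈K = from σ∈K ; τ∈K = from τ∈K ; τ∣σ = τ∣σ ; degτσ = degτσ
  ; σ-maximal = λ ρ → σ-maximal ρ ∘ to
  ; τ-free = λ ρ → τ-free ρ ∘ to
  ; result = λ ρ → (λ Lρ → Data.Product.map₁ from (proj₁ (result ρ) Lρ))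
                 , (λ (Kρ , ρ≉) → proj₂ (result ρ) (to Kρ , ρ≉)) }
  where
  open ElemCollapse e
  to   = λ {ρ} → proj₁ (K≐K' ρ)
  from = λ {ρ} → proj₂ (K≐K' ρ)

Collapses-respˡ : {K K' : Complex n} {P : Complex n → Set} → (∀ {L L'} → L ≐ L' → P L' → P L) →
                  K ≐ K' → Σ (Complex n) (λ L → Collapses K' L × P L) →
                  Σ (Complex n) (λ L → Collapses K L × P L)
Collapses-respˡ P-resp K≐K' (L , ε , PL)     = _ , ε , P-resp K≐K' PL
Collapses-respˡ P-resp K≐K' (L , e ◅ c , PL) = L , ElemCollapse-respˡ K≐K' e ◅ c , PL

IsPoint-resp : {K K' : Complex n} → K ≐ K' → IsPoint K' → IsPoint K
IsPoint-resp K≐K' (v , point) =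
  v , λ m → proj₁ (point m) ∘ proj₁ (K≐K' m) , proj₂ (K≐K' m) ∘ proj₂ (point m)

IsCrossPolytopeBoundary-resp : {K K' : Complex n} {d : ℕ} → K ≐ K' →
                               IsCrossPolytopeBoundary K' d → IsCrossPolytopeBoundary K d
IsCrossPolytopeBoundary-resp K≐K' (f , f-injective , cross) =
  f , f-injective , λ m → proj₁ (cross m) ∘ proj₁ (K≐K' m) , proj₂ (K≐K' m) ∘ proj₂ (cross m)

⟪_⟫ : {P : Pred (Fin n) ℓ} → Decidable P → Subset n
⟪ P? ⟫ = tabulate (isYes ∘ P?)

module _ {P : Pred (Fin n) ℓ} {P? : Decidable P} where

  ∈⟪⟫⁺ : P i → i ∈ ⟪ P? ⟫
  ∈⟪⟫⁺ {i = i} p =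
    lookup⇒[]= i ⟪ P? ⟫ (trans (lookup∘tabulate (isYes ∘ P?) i) (Equivalence.to T-≡ (fromWitness p)))

  ∈⟪⟫⁻ : i ∈ ⟪ P? ⟫ → P i
  ∈⟪⟫⁻ {i = i} i∈ =
    toWitness (Equivalence.from T-≡ (trans (sym (lookup∘tabulate (isYes ∘ P?) i)) ([]=⇒lookup i∈)))

∈─⁻ : (p q : Subset n) → i ∈ p ─ q → i ∈ p × i ∉ q
∈─⁻              (inside ∷ p)  (outside ∷ q) here = here , λ ()
∈─⁻ {i = zero}   (outside ∷ p) (inside ∷ q)  ()
∈─⁻ {i = zero}   (outside ∷ p) (outside ∷ q) ()
∈─⁻ {i = suc i}  (_ ∷ p)       (_ ∷ q)       (there i∈) with i∈p , i∉q ← ∈─⁻ p q i∈ =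
  there i∈p , i∉q ∘ drop-there

∈-⁻ : (p : Subset n) → i ∈ p - a → i ∈ p × i ≢ a
∈-⁻ p i∈ = proj₁ (∈─⁻ p _ i∈) , x∉⁅y⁆⇒x≢y (proj₂ (∈─⁻ p _ i∈))

∈-flip⁻ : (S : Subset n) → a ∈ S [ a ]%= not → a ∉ S
∈-flip⁻ {a = a} S a∈ a∈S = contradiction (trans (sym (lookup∘updateAt a S)) ([]=⇒lookup a∈))
                                         (subst (λ x → not x ≢ true) (sym ([]=⇒lookup a∈S)) λ ())

∉-flip⁺ : (S : Subset n) → a ∉ S → a ∈ S [ a ]%= not
∉-flip⁺ {a = a} S a∉S =
  lookup⇒[]= a _ (trans (lookup∘updateAt a S) (cong not (¬-true (a∉S ∘ lookup⇒[]= a S))))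
  where
  ¬-true : ∀ {x} → x ≢ true → x ≡ false
  ¬-true {false} _ = refl
  ¬-true {true}  x≢true = contradiction refl x≢true

∈-flip-other : (S : Subset n) → i ≢ a → i ∈ S [ a ]%= not ⇔ i ∈ S
∈-flip-other {i = i} {a = a} S i≢a = mk⇔
  (λ i∈ → lookup⇒[]= i S (trans (sym (lookup∘updateAt′ i a i≢a S)) ([]=⇒lookup i∈)))
  (λ i∈ → lookup⇒[]= i _ (trans (lookup∘updateAt′ i a i≢a S) ([]=⇒lookup i∈)))

≐-sym : I ≐ I' → I' ≐ I
≐-sym I≐I' m = proj₂ (I≐I' m) , proj₁ (I≐I' m)

≐-trans : I ≐ I' → I' ≐ I'' → I ≐ I''
≐-trans I≐I' I'≐I'' m = proj₁ (I'≐I'' m) ∘ proj₁ (I≐I' m) , proj₂ (I≐I' m) ∘ proj₂ (I'≐I'' m)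

∶-cong : (u : Monomial n) → I ≐ I' → (I ∶ u) ≐ (I' ∶ u)
∶-cong u I≐I' m = I≐I' (u · m)

,,-cong : (a : Fin n) → I ≐ I' → (I ,, a) ≐ (I' ,, a)
,,-cong a I≐I' m = Data.Sum.map₁ (proj₁ (I≐I' m)) , Data.Sum.map₁ (proj₂ (I≐I' m))

IsCone-resp : I ≐ I' → IsCone I a → IsCone I' a
IsCone-resp {a = a} I≐I' cone = ≐-trans (∶-cong (var a) (≐-sym I≐I')) (≐-trans cone (,,-cong a I≐I'))

Dominates-resp : I ≐ I' → Dominates I a b → Dominates I' a b
Dominates-resp {a = a} I≐I' (¬cone , cone) =
  ¬cone ∘ IsCone-resp (≐-sym I≐I') , IsCone-resp (,,-cong a I≐I') cone

resolution-++ : (A : List (Fin n)) → IsResolution I A → IsResolution (coreOf I A) B →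
                IsResolution I (A ++ B)
resolution-++ []      _                   res = res
resolution-++ (a ∷ A) (a∉I , step , res₁) res = a∉I , step , resolution-++ A res₁ res

resolution-++⁻ : (A : List (Fin n)) → IsResolution I (A ++ B) → IsResolution (coreOf I A) B
resolution-++⁻ []      res             = res
resolution-++⁻ (a ∷ A) (_ , _ , res) = resolution-++⁻ A res

module _ {n : ℕ} (F : Graph n) where

  infix 4 _~_ _~?_

  _~_ : Fin n → Fin n → Set
  i ~ j = T (Adj F i j)

  _~?_ : (i j : Fin n) → Dec (i ~ j)
  i ~? j = T? (Adj F i j)

  ~-sym : i ~ j → j ~ i
  ~-sym {i = i} {j = j} = subst T (Graph.sym F i j)

  ~-irrefl : ¬ i ~ i
  ~-irrefl {i = i} = subst T (Graph.irrefl F i)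

  N[_] : Fin n → Subset n
  N[ a ] = ⟪ (λ i → i ≟ a ⊎-dec a ~? i) ⟫

  ∈─N[]⁻ : i ∈ W ─ N[ a ] → i ∈ W × i ≢ a × ¬ a ~ i
  ∈─N[]⁻ {W = W} {a = a} i∈ =
    proj₁ (∈─⁻ W N[ a ] i∈) , (λ i≡a → proj₂ (∈─⁻ W N[ a ] i∈) (∈⟪⟫⁺ (inj₁ i≡a)))
                            , (λ a~i → proj₂ (∈─⁻ W N[ a ] i∈) (∈⟪⟫⁺ (inj₂ a~i)))

  ∈─N[]⁺ : i ∈ W → i ≢ a → ¬ a ~ i → i ∈ W ─ N[ a ]
  ∈─N[]⁺ i∈W i≢a a≁i = x∈p∧x∉q⇒x∈p─q i∈W λ i∈N → [ i≢a , a≁i ]′ (∈⟪⟫⁻ i∈N)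

  Isolated : Subset n → Fin n → Set
  Isolated W a = ∀ u → u ∈ W → ¬ a ~ u

  isolated? : (W : Subset n) (a : Fin n) → Dec (Isolated W a)
  isolated? W a = all? λ u → u ∈? W →-dec ¬? (a ~? u)

  PendantAt : Subset n → Fin n → Fin n → Set
  PendantAt W a b = b ∈ W × a ~ b × (∀ {u} → u ∈ W → b ~ u → u ≡ a)

  isolated⇒─N[]≡- : Isolated W a → W ─ N[ a ] ≡ W - a
  isolated⇒─N[]≡- {W = W} isolated = ⊆-antisym
    (λ i∈ → let (i∈W , i≢a , _) = ∈─N[]⁻ i∈ in x∈p∧x≢y⇒x∈p-y i∈W i≢a)
    (λ i∈ → let (i∈W , i≢a) = ∈-⁻ W i∈ in ∈─N[]⁺ i∈W i≢a (isolated _ i∈W))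

  ─N[]⊂ : a ∈ W → W ─ N[ a ] ⊂ W
  ─N[]⊂ {a = a} {W = W} a∈W = p─q⊆p W N[ a ] , a , a∈W , λ a∈ → proj₁ (proj₂ (∈─N[]⁻ a∈)) refl

  Ind : Subset n → Complex n
  Ind U m = SquareFree m × (∀ i → 1 ≤ m i → i ∈ U) × (∀ i j → ¬ (i ~ j × 1 ≤ m i × 1 ≤ m j))

  Ind-isComplex : IsComplex (Ind U)
  Ind-isComplex {U = U} = record
    { squareFree = proj₁
    ; downward = λ (sf , supp , indep) d →
        squareFree-∣ₘ sf d
        , (λ i 1≤ → supp i (≤-trans 1≤ (d i)))
        , (λ i j (i~j , 1≤i , 1≤j) → indep i j (i~j , ≤-trans 1≤i (d i) , ≤-trans 1≤j (d j)))
    ; decidable = λ m →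
        all? (λ i → m i ≤? 1)
        ×-dec all? (λ i → 1 ≤? m i →-dec i ∈? U)
        ×-dec all? (λ i → all? λ j →
                ¬? (i ~? j ×-dec 1 ≤? m i ×-dec 1 ≤? m j)) }

  Ind-mono : U ⊆ U' → Ind U m → Ind U' m
  Ind-mono U⊆U' (sf , supp , indep) = sf , (λ i 1≤ → U⊆U' (supp i 1≤)) , indep

  one∈Ind : Ind U one
  one∈Ind = (λ _ → z≤n) , (λ _ ()) , λ _ _ ()

  var∈Ind : a ∈ U → Ind U (var a)
  var∈Ind {a = a} a∈U =
    var-squareFree a
    , (λ i 1≤ → subst (_∈ _) (sym (var-support 1≤)) a∈U)
    , λ i j (i~j , 1≤i , 1≤j) → ~-irrefl (subst₂ _~_ (var-support 1≤i) (var-support 1≤j) i~j)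

  R-edgeIdeal≐Ind : R (edgeIdeal F) ≐ Ind full
  R-edgeIdeal≐Ind m = to , from
    where
    to : R (edgeIdeal F) m → Ind full m
    to ¬edge = sf , (λ _ _ → ∈⊤) , λ i j (i~j , 1≤i , 1≤j) → ¬edge (inj₂ (i , j , i~j , 1≤i , 1≤j))
      where
      sf : SquareFree m
      sf i with m i ≤? 1
      ... | yes ≤1 = ≤1
      ... | no  ≰1 = contradiction (inj₁ (i , ≰⇒> ≰1)) ¬edge
    from : Ind full m → R (edgeIdeal F) m
    from (sf , _ , _)     (inj₁ (i , 2≤))                   = contradiction (≤-trans 2≤ (sf i)) λ { (s≤s ()) }
    from (_ , _ , indep) (inj₂ (i , j , i~j , 1≤i , 1≤j)) = indep i j (i~j , 1≤i , 1≤j)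

  RemovableVia : Subset n → Fin n → Fin n → Set
  RemovableVia U b c = b ≢ c × ¬ b ~ c × (∀ {u} → u ∈ U → b ~ u → c ~ u)

  -- Toggling b pairs up the faces of Ind U through c, because N(b) ⊆ N(c).
  Ind-collapses-remove : b ∈ U → c ∈ U → RemovableVia U b c → Collapses (Ind U) (Ind (U - c))
  Ind-collapses-remove {b = b} {U = U} {c = c} b∈U c∈U (b≢c , b≁c , N[b]⊆N[c]) =
    collapses-byToggle Ind-isComplex Ind-isComplex (Ind-mono (p─q⊆p U ⁅ c ⁆)) closed
      (var∈Ind c∈U) (λ (_ , supp , _) → proj₂ (∈-⁻ U (supp c (≤-reflexive (sym (var-diag c))))) refl)
    where
    c∈face : Ind U m → ¬ Ind (U - c) m → 1 ≤ m c
    c∈face {m = m} (sf , supp , indep) ¬Ind with 1 ≤? m c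
    ... | yes 1≤ = 1≤
    ... | no  1≰ = contradiction (sf , supp' , indep) ¬Ind
      where
      supp' : ∀ i → 1 ≤ m i → i ∈ U - c
      supp' i 1≤ = x∈p∧x≢y⇒x∈p-y (supp i 1≤) λ { refl → 1≰ 1≤ }

    closed : ToggleClosed b (Ind U) (Ind (U - c))
    closed {m} Km@(sf , supp , indep) ¬Lm =
      (toggle-squareFree b sf , supp' , indep') , λ (_ , supp'' , _) → proj₂ (∈-⁻ U (supp'' c 1≤c)) refl
      where
      1≤c : 1 ≤ toggle b m c
      1≤c = subst (1 ≤_) (sym (toggle-off (b≢c ∘ sym))) (c∈face Km ¬Lm)
      supp' : ∀ i → 1 ≤ toggle b m i → i ∈ U
      supp' i 1≤ with toggle-support b m i 1≤
      ... | inj₁ refl = b∈U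
      ... | inj₂ 1≤m = supp i 1≤m
      no-edge-at-b : ∀ {j} → b ~ j → 1 ≤ toggle b m j → ⊥
      no-edge-at-b {j} b~j 1≤j with toggle-support b m j 1≤j
      ... | inj₁ refl = ~-irrefl b~j
      ... | inj₂ 1≤m = indep c j (N[b]⊆N[c] (supp j 1≤m) b~j , c∈face Km ¬Lm , 1≤m)
      indep' : ∀ i j → ¬ (i ~ j × 1 ≤ toggle b m i × 1 ≤ toggle b m j)
      indep' i j (i~j , 1≤i , 1≤j) with toggle-support b m i 1≤i | toggle-support b m j 1≤j
      ... | inj₁ refl | _         = no-edge-at-b i~j 1≤j
      ... | inj₂ _    | inj₁ refl = no-edge-at-b (~-sym i~j) 1≤i
      ... | inj₂ 1≤mi | inj₂ 1≤mj = indep i j (i~j , 1≤mi , 1≤mj)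

  Ind-collapses-removeAll : b ∈ U → b ∉ D → (∀ {c} → c ∈ D → c ∈ U → RemovableVia U b c) →
                            Collapses (Ind U) (Ind (U ─ D))
  Ind-collapses-removeAll {b = b} {D = D} = go (⊂-wellFounded _)
    where
    go : ∀ {U} → Acc _⊂_ U → b ∈ U → b ∉ D → (∀ {c} → c ∈ D → c ∈ U → RemovableVia U b c) →
         Collapses (Ind U) (Ind (U ─ D))
    go {U} (acc rec) b∈U b∉D removable with any? (λ c → c ∈? U ×-dec c ∈? D)
    ... | no none = subst (λ X → Collapses (Ind U) (Ind X)) (sym U─D≡U) ε
      where
      U─D≡U : U ─ D ≡ U
      U─D≡U = ⊆-antisym (p─q⊆p U D) λ c∈U → x∈p∧x∉q⇒x∈p─q c∈U λ c∈D → none (_ , c∈U , c∈D)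
    ... | yes (c , c∈U , c∈D) =
      Ind-collapses-remove b∈U c∈U (removable c∈D c∈U)
      ◅◅ subst (λ X → Collapses (Ind (U - c)) (Ind X)) U-c─D≡U─D
           (go (rec (x∈p⇒p-x⊂p c∈U)) (x∈p∧x≢y⇒x∈p-y b∈U λ { refl → b∉D c∈D }) b∉D removable')
      where
      removable' : ∀ {c'} → c' ∈ D → c' ∈ U - c → RemovableVia (U - c) b c'
      removable' c'∈D c'∈U-c with removable c'∈D (proj₁ (∈-⁻ U c'∈U-c))
      ... | b≢c' , b≁c' , N⊆N = b≢c' , b≁c' , λ u∈U-c → N⊆N (proj₁ (∈-⁻ U u∈U-c))
      U-c─D≡U─D : U - c ─ D ≡ U ─ D
      U-c─D≡U─D = ⊆-antisym
        (λ i∈ → let (i∈U-c , i∉D) = ∈─⁻ (U - c) D i∈ in x∈p∧x∉q⇒x∈p─q (proj₁ (∈-⁻ U i∈U-c)) i∉D)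
        (λ i∈ → let (i∈U , i∉D) = ∈─⁻ U D i∈ in
                x∈p∧x∉q⇒x∈p─q (x∈p∧x≢y⇒x∈p-y i∈U λ { refl → i∉D c∈D }) i∉D)

  Ind-collapses-point : a ∈ U → Isolated U a → Collapses (Ind U) (Ind ⁅ a ⁆)
  Ind-collapses-point {a = a} {U = U} a∈U isolated =
    subst (λ X → Collapses (Ind U) (Ind X)) U─others≡⁅a⁆
      (Ind-collapses-removeAll a∈U (λ a∈others → ∈⟪⟫⁻ a∈others refl) removable)
    where
    others : Subset n
    others = ⟪ (λ c → ¬? (c ≟ a)) ⟫
    removable : ∀ {c} → c ∈ others → c ∈ U → RemovableVia U a c
    removable c∈others c∈U =
      (λ a≡c → ∈⟪⟫⁻ c∈others (sym a≡c)) , isolated _ c∈U , λ u∈U a~u → contradiction a~u (isolated _ u∈U)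
    U─others≡⁅a⁆ : U ─ others ≡ ⁅ a ⁆
    U─others≡⁅a⁆ = ⊆-antisym
      (λ i∈ → subst (_∈ ⁅ a ⁆) (sym (decidable-stable (_ ≟ a) λ i≢a → proj₂ (∈─⁻ U others i∈) (∈⟪⟫⁺ i≢a)))
                    (x∈⁅x⁆ a))
      (λ i∈ → subst (_∈ U ─ others) (sym (x∈⁅y⁆⇒x≡y a i∈))
                    (x∈p∧x∉q⇒x∈p─q a∈U λ a∈others → ∈⟪⟫⁻ a∈others refl))

  Ind-point : (a : Fin n) → IsPoint (Ind ⁅ a ⁆)
  Ind-point a = a , λ m → to , from
    where
    off-a : Ind ⁅ a ⁆ m → i ≢ a → m i ≡ 0
    off-a {i = i} (sf , supp , _) i≢a with n≤1⇒n≡0∨n≡1 (sf i)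
    ... | inj₁ mi≡0 = mi≡0
    ... | inj₂ mi≡1 = contradiction (x∈⁅y⁆⇒x≡y a (supp i (≤-reflexive (sym mi≡1)))) i≢a
    to : Ind ⁅ a ⁆ m → m ≈ₘ one ⊎ m ≈ₘ var a
    to Im@(sf , _) with n≤1⇒n≡0∨n≡1 (sf a)
    ... | inj₁ ma≡0 = inj₁ λ i →
      [ (λ { (refl , _) → ma≡0 }) , (λ (i≢a , _) → off-a Im i≢a) ]′ (var-cases a i)
    ... | inj₂ ma≡1 = inj₂ λ i →
      [ (λ { (refl , e) → trans ma≡1 (sym e) }) , (λ (i≢a , e) → trans (off-a Im i≢a) (sym e)) ]′ (var-cases a i)
    from : m ≈ₘ one ⊎ m ≈ₘ var a → Ind ⁅ a ⁆ m
    from (inj₁ m≈one) = IsComplex.≈-closed Ind-isComplex one∈Ind (≈ₘ-sym m≈one)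
    from (inj₂ m≈a)   = IsComplex.≈-closed Ind-isComplex (var∈Ind (x∈⁅x⁆ a)) (≈ₘ-sym m≈a)

  -- The ideals met along a resolution of the edge ideal: Ḡ plus the variables outside W.
  edgeIdealOn : Subset n → Ideal n
  edgeIdealOn W m = edgeIdeal F m ⊎ ∃[ i ] (i ∉ W × 1 ≤ m i)

  edgeIdealOn-∣ : m ∣ₘ m' → edgeIdealOn W m → edgeIdealOn W m'
  edgeIdealOn-∣ d (inj₁ (inj₁ (i , 2≤))) = inj₁ (inj₁ (i , ≤-trans 2≤ (d i)))
  edgeIdealOn-∣ d (inj₁ (inj₂ (i , j , i~j , 1≤i , 1≤j))) =
    inj₁ (inj₂ (i , j , i~j , ≤-trans 1≤i (d i) , ≤-trans 1≤j (d j)))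
  edgeIdealOn-∣ d (inj₂ (i , i∉W , 1≤)) = inj₂ (i , i∉W , ≤-trans 1≤ (d i))

  edgeIdeal≐edgeIdealOn-full : edgeIdeal F ≐ edgeIdealOn full
  edgeIdeal≐edgeIdealOn-full m = inj₁ , [ id , (λ (_ , i∉full , _) → contradiction ∈⊤ i∉full) ]′

  edgeIdealOn-empty : Empty W → edgeIdealOn W ≐ maxIdeal
  edgeIdealOn-empty empty m = to , λ (i , 1≤) → inj₂ (i , (λ i∈W → empty (i , i∈W)) , 1≤)
    where
    to : edgeIdealOn _ m → maxIdeal m
    to (inj₁ (inj₁ (i , 2≤)))           = i , ≤-trans (s≤s z≤n) 2≤
    to (inj₁ (inj₂ (i , _ , _ , 1≤ , _))) = i , 1≤
    to (inj₂ (i , _ , 1≤))              = i , 1≤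

  var∈edgeIdealOn : a ∉ W → edgeIdealOn W (var a)
  var∈edgeIdealOn {a = a} a∉W = inj₂ (a , a∉W , ≤-reflexive (sym (var-diag a)))

  var∉edgeIdealOn : a ∈ W → ¬ edgeIdealOn W (var a)
  var∉edgeIdealOn {a = a} a∈W (inj₁ (inj₁ (i , 2≤))) =
    contradiction (≤-trans 2≤ (var-squareFree a i)) λ { (s≤s ()) }
  var∉edgeIdealOn {a = a} a∈W (inj₁ (inj₂ (i , j , i~j , 1≤i , 1≤j))) =
    ~-irrefl (subst₂ _~_ (var-support 1≤i) (var-support 1≤j) i~j)
  var∉edgeIdealOn {a = a} a∈W (inj₂ (i , i∉W , 1≤)) = i∉W (subst (_∈ _) (sym (var-support 1≤)) a∈W)

  one∉edgeIdealOn : ¬ edgeIdealOn W one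
  one∉edgeIdealOn (inj₁ (inj₁ (_ , ())))
  one∉edgeIdealOn (inj₁ (inj₂ (_ , _ , _ , () , _)))
  one∉edgeIdealOn (inj₂ (_ , _ , ()))

  edgeIdealOn-colon : a ∈ W → (edgeIdealOn W ∶ var a) ≐ edgeIdealOn (W ─ N[ a ])
  edgeIdealOn-colon {a = a} {W = W} a∈W m = to , from
    where
    a∈am : 1 ≤ (var a · m) a
    a∈am = ≤-trans (≤-reflexive (sym (var-diag a))) (m≤m+n (var a a) (m a))
    m∣am : m ∣ₘ (var a · m)
    m∣am i = m≤n+m (m i) (var a i)

    -- Matching on i ≟ a also evaluates var a i in the types of 2≤, 1≤i, 1≤j and 1≤ below.
    to : edgeIdealOn W (var a · m) → edgeIdealOn (W ─ N[ a ]) m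
    to (inj₁ (inj₁ (i , 2≤))) with i ≟ a
    ... | yes refl = inj₂ (a , (λ a∈ → proj₁ (proj₂ (∈─N[]⁻ a∈)) refl) , ≤-pred 2≤)
    ... | no  i≢a  = inj₁ (inj₁ (i , 2≤))
    to (inj₁ (inj₂ (i , j , i~j , 1≤i , 1≤j))) with i ≟ a | j ≟ a
    ... | yes refl | yes refl = contradiction i~j ~-irrefl
    ... | yes refl | no  j≢a  = inj₂ (j , (λ j∈ → proj₂ (proj₂ (∈─N[]⁻ j∈)) i~j) , 1≤j)
    ... | no  i≢a  | yes refl = inj₂ (i , (λ i∈ → proj₂ (proj₂ (∈─N[]⁻ i∈)) (~-sym i~j)) , 1≤i)
    ... | no  i≢a  | no  j≢a  = inj₁ (inj₂ (i , j , i~j , 1≤i , 1≤j))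
    to (inj₂ (i , i∉W , 1≤)) with i ≟ a
    ... | yes refl = contradiction a∈W i∉W
    ... | no  i≢a  = inj₂ (i , i∉W ∘ proj₁ ∘ ∈─N[]⁻ , 1≤)

    from : edgeIdealOn (W ─ N[ a ]) m → edgeIdealOn W (var a · m)
    from (inj₁ e) = edgeIdealOn-∣ m∣am (inj₁ e)
    from (inj₂ (i , i∉ , 1≤)) with i ≟ a | a ~? i
    ... | yes refl | _       = inj₁ (inj₁ (a , subst (2 ≤_) (sym (cong (_+ m a) (var-diag a))) (s≤s 1≤)))
    ... | no  i≢a  | yes a~i = inj₁ (inj₂ (a , i , a~i , a∈am , ≤-trans 1≤ (m∣am i)))
    ... | no  i≢a  | no  a≁i = inj₂ (i , (λ i∈W → i∉ (∈─N[]⁺ i∈W i≢a a≁i)) , ≤-trans 1≤ (m∣am i))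

  edgeIdealOn-extend : (edgeIdealOn W ,, a) ≐ edgeIdealOn (W - a)
  edgeIdealOn-extend {W = W} {a = a} m = to , from
    where
    to : (edgeIdealOn W ,, a) m → edgeIdealOn (W - a) m
    to (inj₁ (inj₁ e))              = inj₁ e
    to (inj₁ (inj₂ (i , i∉W , 1≤))) = inj₂ (i , i∉W ∘ proj₁ ∘ ∈-⁻ W , 1≤)
    to (inj₂ a∣m)                   =
      inj₂ (a , (λ a∈ → proj₂ (∈-⁻ W a∈) refl) , subst (_≤ m a) (var-diag a) (a∣m a))
    from : edgeIdealOn (W - a) m → (edgeIdealOn W ,, a) m
    from (inj₁ e) = inj₁ (inj₁ e)
    from (inj₂ (i , i∉ , 1≤)) with i ≟ a
    ... | yes refl = inj₂ (var-∣ 1≤)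
    ... | no  i≢a  = inj₁ (inj₂ (i , (λ i∈W → i∉ (x∈p∧x≢y⇒x∈p-y i∈W i≢a)) , 1≤))

  isolated⇒isCone : a ∈ W → Isolated W a → IsCone (edgeIdealOn W) a
  isolated⇒isCone {a = a} {W = W} a∈W isolated =
    ≐-trans (edgeIdealOn-colon a∈W)
            (subst (λ X → edgeIdealOn X ≐ (edgeIdealOn W ,, a)) (sym (isolated⇒─N[]≡- isolated))
                   (≐-sym edgeIdealOn-extend))

  isCone⇒isolated : IsCone (edgeIdealOn W) a → Isolated W a
  isCone⇒isolated {W = W} {a = a} cone u u∈W a~u =
    var∉edgeIdealOn (x∈p∧x≢y⇒x∈p-y u∈W u≢a)
                    (proj₁ (edgeIdealOn-extend (var u)) (proj₁ (cone (var u)) edge))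
    where
    u≢a : u ≢ a
    u≢a refl = ~-irrefl a~u
    edge : edgeIdealOn W (var a · var u)
    edge = inj₁ (inj₂ (a , u , a~u , ≤-trans (≤-reflexive (sym (var-diag a))) (m≤m+n _ _)
                                    , ≤-trans (≤-reflexive (sym (var-diag u))) (m≤n+m _ _)))

  isCone⇒∈ : IsCone (edgeIdealOn W) a → a ∈ W
  isCone⇒∈ {W = W} {a = a} cone = decidable-stable (a ∈? W) λ a∉W →
    [ one∉edgeIdealOn , (λ a∣one → contradiction (subst (_≤ 0) (var-diag a) (a∣one a)) λ ()) ]′
      (proj₁ (cone one) (edgeIdealOn-∣ (∣ₘ-· (var a) one) (var∈edgeIdealOn a∉W)))

  dominates⇒pendant : Dominates (edgeIdealOn W) a b → PendantAt W a b
  dominates⇒pendant {W = W} {a = a} {b = b} (¬cone , cone) = b∈W , a~b , leaf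
    where
    cone' : IsCone (edgeIdealOn (W - a)) b
    cone' = IsCone-resp edgeIdealOn-extend cone
    b∈W : b ∈ W
    b∈W = proj₁ (∈-⁻ W (isCone⇒∈ cone'))
    leaf : ∀ {u} → u ∈ W → b ~ u → u ≡ a
    leaf {u} u∈W b~u = decidable-stable (u ≟ a) λ u≢a → isCone⇒isolated cone' u (x∈p∧x≢y⇒x∈p-y u∈W u≢a) b~u
    a~b : a ~ b
    a~b = decidable-stable (a ~? b) λ a≁b →
      ¬cone (isolated⇒isCone b∈W λ u u∈W b~u → a≁b (~-sym (subst (b ~_) (leaf u∈W b~u) b~u)))

  pendant⇒dominates : a ∈ W → PendantAt W a b → Dominates (edgeIdealOn W) a b
  pendant⇒dominates {a = a} {W = W} {b = b} a∈W (b∈W , a~b , leaf) =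
    (λ cone → isCone⇒isolated cone a a∈W (~-sym a~b)) ,
    IsCone-resp (≐-sym edgeIdealOn-extend)
      (isolated⇒isCone (x∈p∧x≢y⇒x∈p-y b∈W b≢a) λ u u∈ b~u →
         proj₂ (∈-⁻ W u∈) (leaf (proj₁ (∈-⁻ W u∈)) b~u))
    where
    b≢a : b ≢ a
    b≢a refl = ~-irrefl a~b

  PruningStep : Subset n → Fin n → Set
  PruningStep W a = Isolated W a ⊎ ∃[ b ] PendantAt W a b

  IsPruning : Subset n → List (Fin n) → Set
  IsPruning W []      = ⊤
  IsPruning W (a ∷ A) = a ∈ W × PruningStep W a × IsPruning (W ─ N[ a ]) A

  NoIsolatedStep : Subset n → List (Fin n) → Set
  NoIsolatedStep W []      = ⊤
  NoIsolatedStep W (a ∷ A) = ¬ Isolated W a × NoIsolatedStep (W ─ N[ a ]) A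

  noIsolatedStep? : (W : Subset n) (A : List (Fin n)) → Dec (NoIsolatedStep W A)
  noIsolatedStep? W []      = yes tt
  noIsolatedStep? W (a ∷ A) = ¬? (isolated? W a) ×-dec noIsolatedStep? (W ─ N[ a ]) A

  pruned : Subset n → List (Fin n) → Subset n
  pruned W []      = W
  pruned W (a ∷ A) = pruned (W ─ N[ a ]) A

  colon-≐ : I ≐ edgeIdealOn W → a ∈ W → (I ∶ var a) ≐ edgeIdealOn (W ─ N[ a ])
  colon-≐ {a = a} I≐ a∈W = ≐-trans (∶-cong (var a) I≐) (edgeIdealOn-colon a∈W)

  resolution⇒pruning : I ≐ edgeIdealOn W → IsResolution I A → IsPruning W A
  resolution⇒pruning {A = []}    I≐ _                  = tt
  resolution⇒pruning {W = W} {A = a ∷ A} I≐ (a∉I , step , res) =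
    a∈W
    , Data.Sum.map (isCone⇒isolated ∘ IsCone-resp I≐)
                   (Data.Product.map₂ (dominates⇒pendant ∘ Dominates-resp I≐)) step
    , resolution⇒pruning (colon-≐ I≐ a∈W) res
    where
    a∈W : a ∈ W
    a∈W = decidable-stable (a ∈? W) λ a∉W → a∉I (proj₂ (I≐ (var a)) (var∈edgeIdealOn a∉W))

  pruning⇒resolution : I ≐ edgeIdealOn W → IsPruning W A → IsResolution I A
  pruning⇒resolution {A = []}    I≐ _                     = tt
  pruning⇒resolution {A = a ∷ A} I≐ (a∈W , step , pruning) =
    var∉edgeIdealOn a∈W ∘ proj₁ (I≐ (var a))
    , Data.Sum.map (IsCone-resp (≐-sym I≐) ∘ isolated⇒isCone a∈W)
                   (Data.Product.map₂ (Dominates-resp (≐-sym I≐) ∘ pendant⇒dominates a∈W)) step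
    , pruning⇒resolution (colon-≐ I≐ a∈W) pruning

  coreOf-≐ : I ≐ edgeIdealOn W → IsPruning W A → coreOf I A ≐ edgeIdealOn (pruned W A)
  coreOf-≐ {A = []}    I≐ _                 = I≐
  coreOf-≐ {A = a ∷ A} I≐ (a∈W , _ , pruning) = coreOf-≐ (colon-≐ I≐ a∈W) pruning

  sphericalSeq⇒noIsolatedStep : I ≐ edgeIdealOn W → IsPruning W A →
                                IsSphericalSeq I A → NoIsolatedStep W A
  sphericalSeq⇒noIsolatedStep {A = []}    I≐ _                  _              = tt
  sphericalSeq⇒noIsolatedStep {A = a ∷ A} I≐ (a∈W , _ , pruning) (¬cone , sph) =
    ¬cone ∘ IsCone-resp (≐-sym I≐) ∘ isolated⇒isCone a∈W
    , sphericalSeq⇒noIsolatedStep (colon-≐ I≐ a∈W) pruning sph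

  noIsolatedStep⇒sphericalSeq : I ≐ edgeIdealOn W → IsPruning W A →
                                NoIsolatedStep W A → IsSphericalSeq I A
  noIsolatedStep⇒sphericalSeq {A = []}    I≐ _                  _                  = tt
  noIsolatedStep⇒sphericalSeq {A = a ∷ A} I≐ (a∈W , _ , pruning) (¬isolated , noIso) =
    ¬isolated ∘ isCone⇒isolated ∘ IsCone-resp I≐
    , noIsolatedStep⇒sphericalSeq (colon-≐ I≐ a∈W) pruning noIso

  TwoNeighbours : Subset n → Fin n → Set
  TwoNeighbours W v = ∃[ u ] ∃[ u' ] (u ∈ W × u' ∈ W × v ~ u × v ~ u' × u ≢ u')

  twoNeighbours? : (W : Subset n) (v : Fin n) → Dec (TwoNeighbours W v)
  twoNeighbours? W v =
    any? λ u → any? λ u' → u ∈? W ×-dec u' ∈? W ×-dec v ~? u ×-dec v ~? u' ×-dec ¬? (u ≟ u')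

  -- When every vertex of W has two neighbours in W, a non-backtracking walk in W exists;
  -- its first return to a visited vertex closes a cycle.
  module NonBacktrackingWalk (W : Subset n) (two : ∀ {v} → v ∈ W → TwoNeighbours W v)
                             {v₀} (v₀∈W : v₀ ∈ W) where

    record Position : Set where
      constructor _↦_∶_
      field
        previous current : Fin n
        current∈W        : current ∈ W
    open Position

    advance : (s : Position) → ∃[ y ] (y ∈ W × current s ~ y × y ≢ previous s)
    advance (p ↦ c ∶ c∈W) with two c∈W
    ... | u , u' , u∈W , u'∈W , c~u , c~u' , u≢u' with u ≟ p
    ...   | yes refl = u' , u'∈W , c~u' , u≢u' ∘ sym
    ...   | no  u≢p  = u , u∈W , c~u , u≢p

    walk : ℕ → Position
    walk zero    = v₀ ↦ v₀ ∶ v₀∈W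
    walk (suc k) = current (walk k) ↦ proj₁ (advance (walk k)) ∶ proj₁ (proj₂ (advance (walk k)))

    x : ℕ → Fin n
    x k = current (walk (suc k))

    x-adjacent : ∀ k → x k ~ x (suc k)
    x-adjacent k = proj₁ (proj₂ (proj₂ (advance (walk (suc k)))))

    x-nonbacktracking : ∀ k → x (suc (suc k)) ≢ x k
    x-nonbacktracking k = proj₂ (proj₂ (proj₂ (advance (walk (suc (suc k))))))

    Revisits : ℕ → Set
    Revisits j = ∃[ i ] (i < j × x i ≡ x j)

    some-revisit : ∃[ j ] Revisits j
    some-revisit with pigeonhole (n<1+n n) (x ∘ toℕ)
    ... | i , j , i<j , xi≡xj = toℕ j , toℕ i , i<j , xi≡xj

    cycle : Cycle F
    cycle with least-witness (λ j → anyUpTo? (λ i → x i ≟ x j) j) (proj₂ some-revisit)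
    ... | j , (i , i<j , xi≡xj) , first with m≤n⇒∃[o]m+o≡n i<j
    ... | zero , refl =
      contradiction (subst (x i ~_) (sym (trans xi≡xj (cong x (+-identityʳ (suc i))))) (x-adjacent i)) ~-irrefl
    ... | suc zero , refl =
      contradiction (trans (cong (x ∘ suc) (+-comm 1 i)) (sym xi≡xj)) (x-nonbacktracking i)
    ... | suc (suc k) , refl =
      record { k = k ; c = vertex ; inj = vertex-injective ; steps = steps ; close = close }
      where
      vertex : Fin (suc (suc (suc k))) → Fin n
      vertex t = x (i + toℕ t)
      before-j : ∀ t → i + toℕ t < suc i + suc (suc k)
      before-j t = s≤s (+-monoʳ-≤ i (≤-pred (toℕ<n t)))
      vertex-injective : ∀ {s t} → vertex s ≡ vertex t → s ≡ t
      vertex-injective {s} {t} cs≡ct with <-cmp (toℕ s) (toℕ t)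
      ... | tri≈ _ s≡t _ = toℕ-injective s≡t
      ... | tri< s<t _ _ = contradiction (i + toℕ s , +-monoʳ-< i s<t , cs≡ct) (first (before-j t))
      ... | tri> _ _ t<s = contradiction (i + toℕ t , +-monoʳ-< i t<s , sym cs≡ct) (first (before-j s))
      steps : ∀ t → vertex (inject₁ t) ~ vertex (suc t)
      steps t rewrite toℕ-inject₁ t | +-suc i (toℕ t) = x-adjacent (i + toℕ t)
      close : vertex (fromℕ (suc (suc k))) ~ vertex zero
      close rewrite toℕ-fromℕ (suc (suc k)) | +-identityʳ i =
        subst (x (i + suc (suc k)) ~_) (sym xi≡xj) (x-adjacent (i + suc (suc k)))

  pruningStep-exists : IsForest F → a ∈ W → ∃[ b ] (b ∈ W × PruningStep W b)
  pruningStep-exists {W = W} forest a∈W with any? (λ v → v ∈? W ×-dec ¬? (twoNeighbours? W v))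
  ... | no all-two = contradiction (NonBacktrackingWalk.cycle W two a∈W) forest
    where
    two : ∀ {v} → v ∈ W → TwoNeighbours W v
    two {v} v∈W = decidable-stable (twoNeighbours? W v) λ ¬two → all-two (v , v∈W , ¬two)
  ... | yes (v , v∈W , ¬two) with any? (λ u → u ∈? W ×-dec v ~? u)
  ...   | no  no-neighbour    = v , v∈W , inj₁ λ u u∈W v~u → no-neighbour (u , u∈W , v~u)
  ...   | yes (u , u∈W , v~u) = u , u∈W , inj₂ (v , v∈W , ~-sym v~u , leaf)
    where
    leaf : ∀ {w} → w ∈ W → v ~ w → w ≡ u
    leaf {w} w∈W v~w = decidable-stable (w ≟ u) λ w≢u → ¬two (w , u , w∈W , u∈W , v~w , v~u , w≢u)

  complete-pruning : IsForest F → (W : Subset n) → ∃[ A ] (IsPruning W A × Empty (pruned W A))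
  complete-pruning forest W = go (⊂-wellFounded W)
    where
    go : ∀ {W} → Acc _⊂_ W → ∃[ A ] (IsPruning W A × Empty (pruned W A))
    go {W} (acc rec) with nonempty? W
    ... | no  empty     = [] , tt , empty
    ... | yes (_ , a∈W) with pruningStep-exists forest a∈W
    ...   | b , b∈W , step with go (rec (─N[]⊂ b∈W))
    ...     | A , pruning , empty = b ∷ A , (b∈W , step , pruning) , empty

  maximal⇒prunedEmpty : IsForest F → IsMaximalResolution (edgeIdeal F) A →
                        IsPruning full A × Empty (pruned full A)
  maximal⇒prunedEmpty {A = A} forest (res , maximal) = pruning , empty
    where
    pruning = resolution⇒pruning edgeIdeal≐edgeIdealOn-full res
    empty : Empty (pruned full A)
    empty (_ , a∈) with pruningStep-exists forest a∈
    ... | b , b∈ , step = maximal b (resolution-++ A res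
            (pruning⇒resolution {A = [ b ]} (coreOf-≐ edgeIdeal≐edgeIdealOn-full pruning) (b∈ , step , tt)))

  prunedEmpty⇒maximal : IsPruning full A → Empty (pruned full A) → IsMaximalResolution (edgeIdeal F) A
  prunedEmpty⇒maximal {A = A} pruning empty =
    pruning⇒resolution edgeIdeal≐edgeIdealOn-full pruning ,
    λ b res → proj₁ (resolution-++⁻ A res)
                (proj₂ (coreOf-≐ edgeIdeal≐edgeIdealOn-full pruning (var b))
                       (var∈edgeIdealOn λ b∈ → empty (_ , b∈)))

  -- U is W together with k disjoint edges g (j , false) ~ g (j , true), which touch nothing else in U;
  -- thus Ind U is Ind W joined with the boundary of the k-dimensional cross-polytope.
  record CrossJoin (U W : Subset n) (k : ℕ) (g : Fin k × Bool → Fin n) : Set where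
    field
      W⊆U          : W ⊆ U
      g∈U          : ∀ v → g v ∈ U
      U⊆W∪g        : i ∈ U → i ∈ W ⊎ ∃[ v ] g v ≡ i
      g-injective  : Injective _≡_ _≡_ g
      g∉W          : ∀ v → g v ∉ W
      g-edges      : ∀ v v' → g v ~ g v' → proj₁ v ≡ proj₁ v'
      g-pairs      : ∀ j → g (j , false) ~ g (j , true)
      g≁W          : ∀ v → i ∈ W → ¬ g v ~ i

    neighbour∈W : ∀ {u} → i ∈ W → i ~ u → u ∈ U → u ∈ W
    neighbour∈W i∈W i~u u∈U with U⊆W∪g u∈U
    ... | inj₁ u∈W       = u∈W
    ... | inj₂ (v , refl) = contradiction (~-sym i~u) (g≁W v i∈W)

  noPairs : Fin 0 × Bool → Fin n
  noPairs (() , _)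

  crossJoin-start : CrossJoin full full 0 noPairs
  crossJoin-start = record
    { W⊆U = id ; g∈U = λ { (() , _) } ; U⊆W∪g = inj₁ ; g-injective = λ { {() , _} }
    ; g∉W = λ { (() , _) } ; g-edges = λ { (() , _) } ; g-pairs = λ () ; g≁W = λ { (() , _) } }

  consPair : ∀ {k} → Fin n → Fin n → (Fin k × Bool → Fin n) → Fin (suc k) × Bool → Fin n
  consPair a b g (zero  , false) = a
  consPair a b g (zero  , true)  = b
  consPair a b g (suc j , x)     = g (j , x)

  otherNeighbours : Fin n → Fin n → Subset n
  otherNeighbours a b = ⟪ (λ c → a ~? c ×-dec ¬? (c ≟ b)) ⟫

  ∈otherNeighbours⁻ : c ∈ otherNeighbours a b → a ~ c × c ≢ b
  ∈otherNeighbours⁻ = ∈⟪⟫⁻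

  ∈otherNeighbours⁺ : a ~ c → c ≢ b → c ∈ otherNeighbours a b
  ∈otherNeighbours⁺ a~c c≢b = ∈⟪⟫⁺ (a~c , c≢b)

  module PendantStep {U W k g} (cj : CrossJoin U W k g) {a b} (a∈W : a ∈ W) (pendant : PendantAt W a b)
    where
    open CrossJoin cj

    private
      b∈W : b ∈ W
      b∈W = proj₁ pendant
      a~b : a ~ b
      a~b = proj₁ (proj₂ pendant)
      leaf : ∀ {u} → u ∈ W → b ~ u → u ≡ a
      leaf = proj₂ (proj₂ pendant)
      b∉others : b ∉ otherNeighbours a b
      b∉others b∈ = proj₂ (∈otherNeighbours⁻ b∈) refl
      keep : i ∈ U → (a ~ i → i ≡ b) → i ∈ U ─ otherNeighbours a b
      keep i∈U a~i⇒i≡b =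
        x∈p∧x∉q⇒x∈p─q i∈U λ i∈ → let (a~i , i≢b) = ∈otherNeighbours⁻ i∈ in i≢b (a~i⇒i≡b a~i)

    collapses : Collapses (Ind U) (Ind (U ─ otherNeighbours a b))
    collapses = Ind-collapses-removeAll (W⊆U b∈W) b∉others removable
      where
      removable : ∀ {c} → c ∈ otherNeighbours a b → c ∈ U → RemovableVia U b c
      removable {c} c∈ c∈U =
        (λ b≡c → c≢b (sym b≡c)) ,
        (λ b~c → ~-irrefl (subst (a ~_) (leaf c∈W b~c) a~c)) ,
        (λ u∈U b~u → subst (c ~_) (sym (leaf (neighbour∈W b∈W b~u u∈U) b~u)) (~-sym a~c))
        where
        a~c = proj₁ (∈otherNeighbours⁻ c∈)
        c≢b = proj₂ (∈otherNeighbours⁻ c∈)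
        c∈W = neighbour∈W a∈W a~c c∈U

    private
      g' : Fin (suc k) × Bool → Fin n
      g' = consPair a b g
      b≢a : b ≢ a
      b≢a refl = ~-irrefl a~b
      g'∈W : ∀ x → g' (zero , x) ∈ W
      g'∈W false = a∈W
      g'∈W true  = b∈W

      g'∈U : ∀ v → g' v ∈ U ─ otherNeighbours a b
      g'∈U (zero , false) = keep (W⊆U a∈W) (⊥-elim ∘ ~-irrefl)
      g'∈U (zero , true)  = keep (W⊆U b∈W) (λ _ → refl)
      g'∈U (suc j , x)    = keep (g∈U (j , x)) (⊥-elim ∘ g≁W (j , x) a∈W ∘ ~-sym)

      U'⊆W'∪g' : i ∈ U ─ otherNeighbours a b → i ∈ W ─ N[ a ] ⊎ ∃[ v ] g' v ≡ i
      U'⊆W'∪g' {i} i∈ with ∈─⁻ U (otherNeighbours a b) i∈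
      ... | i∈U , i∉others with U⊆W∪g i∈U
      ...   | inj₂ ((j , x) , e) = inj₂ ((suc j , x) , e)
      ...   | inj₁ i∈W with i ≟ a | a ~? i | i ≟ b
      ...     | yes refl | _       | _        = inj₂ ((zero , false) , refl)
      ...     | no  i≢a  | no  a≁i | _        = inj₁ (∈─N[]⁺ i∈W i≢a a≁i)
      ...     | no  i≢a  | yes a~i | yes refl = inj₂ ((zero , true) , refl)
      ...     | no  i≢a  | yes a~i | no  i≢b  = contradiction (∈otherNeighbours⁺ a~i i≢b) i∉others

      g'-injective : Injective _≡_ _≡_ g'
      g'-injective {zero , false} {zero , false} _ = refl
      g'-injective {zero , true}  {zero , true}  _ = refl
      g'-injective {zero , false} {zero , true}  e = contradiction (sym e) b≢a
      g'-injective {zero , true}  {zero , false} e = contradiction e b≢a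
      g'-injective {zero , x}     {suc j , y}    e = contradiction (subst (_∈ W) e (g'∈W x)) (g∉W (j , y))
      g'-injective {suc j , y}    {zero , x}     e = contradiction (subst (_∈ W) (sym e) (g'∈W x)) (g∉W (j , y))
      g'-injective {suc j , x}    {suc j' , y}   e with g-injective e
      ... | refl = refl

      g'∉W' : ∀ v → g' v ∉ W ─ N[ a ]
      g'∉W' (zero , false) a∈ = proj₁ (proj₂ (∈─N[]⁻ a∈)) refl
      g'∉W' (zero , true)  b∈ = proj₂ (proj₂ (∈─N[]⁻ b∈)) a~b
      g'∉W' (suc j , x)    g∈ = g∉W (j , x) (proj₁ (∈─N[]⁻ g∈))

      g'-edges : ∀ v v' → g' v ~ g' v' → proj₁ v ≡ proj₁ v'
      g'-edges (zero , x)  (zero , y)   _ = refl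
      g'-edges (zero , x)  (suc j , y)  e = contradiction (~-sym e) (g≁W (j , y) (g'∈W x))
      g'-edges (suc j , y) (zero , x)   e = contradiction e (g≁W (j , y) (g'∈W x))
      g'-edges (suc j , x) (suc j' , y) e = cong suc (g-edges (j , x) (j' , y) e)

      g'≁W' : ∀ v → i ∈ W ─ N[ a ] → ¬ g' v ~ i
      g'≁W' (zero , false) i∈ = proj₂ (proj₂ (∈─N[]⁻ i∈))
      g'≁W' (zero , true)  i∈ b~i = proj₁ (proj₂ (∈─N[]⁻ i∈)) (leaf (proj₁ (∈─N[]⁻ i∈)) b~i)
      g'≁W' (suc j , x)    i∈ = g≁W (j , x) (proj₁ (∈─N[]⁻ i∈))

    crossJoin : CrossJoin (U ─ otherNeighbours a b) (W ─ N[ a ]) (suc k) (consPair a b g)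
    crossJoin = record
      { W⊆U = λ i∈ → keep (W⊆U (proj₁ (∈─N[]⁻ i∈))) (⊥-elim ∘ proj₂ (proj₂ (∈─N[]⁻ i∈)))
      ; g∈U = g'∈U
      ; U⊆W∪g = U'⊆W'∪g'
      ; g-injective = g'-injective
      ; g∉W = g'∉W'
      ; g-edges = g'-edges
      ; g-pairs = λ { zero → a~b ; (suc j) → g-pairs j }
      ; g≁W = g'≁W' }

  isolatedStep-collapses : ∀ {k g} → CrossJoin U W k g → a ∈ W → Isolated W a →
                           Collapses (Ind U) (Ind ⁅ a ⁆)
  isolatedStep-collapses cj a∈W isolated =
    Ind-collapses-point (W⊆U a∈W) λ u u∈U a~u → isolated u (neighbour∈W a∈W a~u u∈U) a~u
    where open CrossJoin cj

  module CrossEnd {U W k g} (cj : CrossJoin U W k g) (empty : Empty W) where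
    open CrossJoin cj

    CrossFace : Monomial n → Set
    CrossFace m = (∀ i → (∀ v → g v ≢ i) → m i ≡ 0) × ¬ crossIdeal k (m ∘ g)

    private
      vanishes : ∀ {x} → ¬ 1 ≤ x → x ≡ 0
      vanishes 1≰ = n<1⇒n≡0 (≰⇒> 1≰)

      preimage? : ∀ i → Dec (∃[ v ] g v ≡ i)
      preimage? i with any? (λ j → g (j , false) ≟ i) | any? (λ j → g (j , true) ≟ i)
      ... | yes (j , e) | _           = yes ((j , false) , e)
      ... | no  _       | yes (j , e) = yes ((j , true) , e)
      ... | no  none₁   | no  none₂   =
        no λ { ((j , false) , e) → none₁ (j , e) ; ((j , true) , e) → none₂ (j , e) }

    Ind⇒CrossFace : Ind U m → CrossFace m
    Ind⇒CrossFace {m} (sf , supp , indep) = off-g , λ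
      { (inj₁ (v , 2≤))               → contradiction (≤-trans 2≤ (sf (g v))) λ { (s≤s ()) }
      ; (inj₂ (j , 1≤false , 1≤true)) → indep _ _ (g-pairs j , 1≤false , 1≤true) }
      where
      off-g : ∀ i → (∀ v → g v ≢ i) → m i ≡ 0
      off-g i ∉g with 1 ≤? m i
      ... | no  1≰ = vanishes 1≰
      ... | yes 1≤ with U⊆W∪g (supp i 1≤)
      ...   | inj₁ i∈W     = contradiction (i , i∈W) empty
      ...   | inj₂ (v , e) = contradiction e (∉g v)

    CrossFace⇒Ind : CrossFace m → Ind U m
    CrossFace⇒Ind {m} (off-g , ¬cross) = sf , supp , indep
      where
      zero-off-g : ∀ {i} → ¬ (∃[ v ] g v ≡ i) → m i ≡ 0
      zero-off-g ∉g = off-g _ λ v e → ∉g (v , e)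
      sf : SquareFree m
      sf i with preimage? i
      ... | no  ∉g = ≤-trans (≤-reflexive (zero-off-g ∉g)) z≤n
      ... | yes (v , refl) with m (g v) ≤? 1
      ...   | yes ≤1 = ≤1
      ...   | no  ≰1 = contradiction (inj₁ (v , ≰⇒> ≰1)) ¬cross
      supp : ∀ i → 1 ≤ m i → i ∈ U
      supp i 1≤ with preimage? i
      ... | yes (v , refl) = g∈U v
      ... | no  ∉g         = contradiction (subst (1 ≤_) (zero-off-g ∉g) 1≤) λ ()
      pair-edge : ∀ v v' → g v ~ g v' → 1 ≤ m (g v) → 1 ≤ m (g v') → ⊥
      pair-edge v@(j , x) v'@(j' , y) e 1≤ 1≤' with g-edges v v' e
      ... | refl with x | y
      ...   | false | true  = ¬cross (inj₂ (j , 1≤ , 1≤'))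
      ...   | true  | false = ¬cross (inj₂ (j , 1≤' , 1≤))
      ...   | false | false = ~-irrefl e
      ...   | true  | true  = ~-irrefl e
      indep : ∀ i j → ¬ (i ~ j × 1 ≤ m i × 1 ≤ m j)
      indep i j (i~j , 1≤i , 1≤j) with preimage? i | preimage? j
      ... | yes (v , refl) | yes (v' , refl) = pair-edge v v' i~j 1≤i 1≤j
      ... | no  ∉g         | _               = contradiction (subst (1 ≤_) (zero-off-g ∉g) 1≤i) λ ()
      ... | yes _          | no  ∉g          = contradiction (subst (1 ≤_) (zero-off-g ∉g) 1≤j) λ ()

    isCrossPolytopeBoundary : IsCrossPolytopeBoundary (Ind U) k
    isCrossPolytopeBoundary = g , g-injective , λ m → Ind⇒CrossFace , CrossFace⇒Ind

  collapse-conical : ∀ {k g} → CrossJoin U W k g → IsPruning W A → ¬ NoIsolatedStep W A →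
                     Σ (Complex n) λ K → Collapses (Ind U) K × IsPoint K
  collapse-conical {A = []} _ _ ¬noIsolated = contradiction tt ¬noIsolated
  collapse-conical {W = W} {A = a ∷ A} cj (a∈W , step , pruning) ¬noIsolated with isolated? W a | step
  ... | yes isolated | _             = Ind ⁅ a ⁆ , isolatedStep-collapses cj a∈W isolated , Ind-point a
  ... | no ¬isolated | inj₁ isolated = contradiction isolated ¬isolated
  ... | no ¬isolated | inj₂ (b , pendant)
    with collapse-conical (PendantStep.crossJoin cj a∈W pendant) pruning (¬noIsolated ∘ (¬isolated ,_))
  ...   | K , collapses , point = K , PendantStep.collapses cj a∈W pendant ◅◅ collapses , point

  collapse-spherical : ∀ {k g} → CrossJoin U W k g → IsPruning W A → NoIsolatedStep W A → Empty (pruned W A) →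
                       Σ (Complex n) λ K → Collapses (Ind U) K × IsCrossPolytopeBoundary K (k + length A)
  collapse-spherical {A = []} {k = k} cj _ _ empty =
    Ind _ , ε , subst (IsCrossPolytopeBoundary (Ind _)) (sym (+-identityʳ k)) (CrossEnd.isCrossPolytopeBoundary cj empty)
  collapse-spherical {A = a ∷ A} cj (_ , inj₁ isolated , _) (¬isolated , _) _ =
    contradiction isolated ¬isolated
  collapse-spherical {A = a ∷ A} {k = k} cj (a∈W , inj₂ (b , pendant) , pruning) (_ , noIsolated) empty
    with collapse-spherical (PendantStep.crossJoin cj a∈W pendant) pruning noIsolated empty
  ... | K , collapses , cross =
    K , PendantStep.collapses cj a∈W pendant ◅◅ collapses
      , subst (IsCrossPolytopeBoundary K) (sym (+-suc k (length A))) cross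

  IndependentIn : Subset n → Subset n → Set
  IndependentIn W S = S ⊆ W × (∀ i j → i ∈ S → j ∈ S → ¬ i ~ j)

  independentIn? : (W : Subset n) → Decidable (IndependentIn W)
  independentIn? W S = S ⊆? W ×-dec all? λ i → all? λ j →
                         i ∈? S →-dec j ∈? S →-dec ¬? (i ~? j)

  #independent : Subset n → ℕ
  #independent W = count (independentIn? W)

  #independent-empty : Empty W → #independent W ≡ 1
  #independent-empty {W = W} empty = count-onlyEmpty (independentIn? W) (mk⇔ to from)
    where
    to : ∀ {S} → IndependentIn W S → Empty S
    to (S⊆W , _) (i , i∈S) = empty (i , S⊆W i∈S)
    from : ∀ {S} → Empty S → IndependentIn W S
    from emptyS = (λ i∈S → contradiction (_ , i∈S) emptyS) , λ i _ i∈S _ → contradiction (i , i∈S) emptyS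

  independentIn-avoiding : (IndependentIn W S × a ∉ S) ⇔ IndependentIn (W - a) S
  independentIn-avoiding {W = W} = mk⇔
    (λ ((S⊆W , indep) , a∉S) → (λ i∈S → x∈p∧x≢y⇒x∈p-y (S⊆W i∈S) λ { refl → a∉S i∈S }) , indep)
    (λ (S⊆W-a , indep) → ((proj₁ ∘ ∈-⁻ W ∘ S⊆W-a) , indep) , λ a∈S → proj₂ (∈-⁻ W (S⊆W-a a∈S)) refl)

  independentIn-containing : a ∈ W →
    (IndependentIn W (S [ a ]%= not) × a ∈ S [ a ]%= not) ⇔ IndependentIn (W ─ N[ a ]) S
  independentIn-containing {a = a} {W = W} {S = S} a∈W = mk⇔ to from
    where
    S' = S [ a ]%= not
    to : IndependentIn W S' × a ∈ S' → IndependentIn (W ─ N[ a ]) S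
    to ((S'⊆W , indep) , a∈S') = S⊆ , λ i j i∈S j∈S → indep i j (into i∈S) (into j∈S)
      where
      a∉S = ∈-flip⁻ S a∈S'
      into : ∀ {i} → i ∈ S → i ∈ S'
      into {i} i∈S = Equivalence.from (∈-flip-other S λ { refl → a∉S i∈S }) i∈S
      S⊆ : S ⊆ W ─ N[ a ]
      S⊆ {i} i∈S = ∈─N[]⁺ (S'⊆W (into i∈S)) (λ { refl → a∉S i∈S }) (indep a i a∈S' (into i∈S))
    from : IndependentIn (W ─ N[ a ]) S → IndependentIn W S' × a ∈ S'
    from (S⊆ , indep) = (S'⊆W , indep') , ∉-flip⁺ S λ a∈S → proj₁ (proj₂ (∈─N[]⁻ (S⊆ a∈S))) refl
      where
      S'-cases : ∀ {i} → i ∈ S' → i ≡ a ⊎ i ∈ S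
      S'-cases {i} i∈S' with i ≟ a
      ... | yes i≡a = inj₁ i≡a
      ... | no  i≢a = inj₂ (Equivalence.to (∈-flip-other S i≢a) i∈S')
      S'⊆W : S' ⊆ W
      S'⊆W i∈S' with S'-cases i∈S'
      ... | inj₁ refl = a∈W
      ... | inj₂ i∈S  = proj₁ (∈─N[]⁻ (S⊆ i∈S))
      indep' : ∀ i j → i ∈ S' → j ∈ S' → ¬ i ~ j
      indep' i j i∈S' j∈S' with S'-cases i∈S' | S'-cases j∈S'
      ... | inj₁ refl | inj₁ refl = ~-irrefl
      ... | inj₁ refl | inj₂ j∈S  = proj₂ (proj₂ (∈─N[]⁻ (S⊆ j∈S)))
      ... | inj₂ i∈S  | inj₁ refl = proj₂ (proj₂ (∈─N[]⁻ (S⊆ i∈S))) ∘ ~-sym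
      ... | inj₂ i∈S  | inj₂ j∈S  = indep i j i∈S j∈S

  -- Toggling a turns the independent sets containing a into those of W ─ N[a].
  #independent-split : a ∈ W → #independent W ≡ #independent (W - a) + #independent (W ─ N[ a ])
  #independent-split {a = a} {W = W} a∈W = begin
    #independent W
      ≡⟨ count-split (independentIn? W) (a ∈?_) ⟩
    count (λ S → independentIn? W S ×-dec ¬? (a ∈? S)) + count (λ S → independentIn? W S ×-dec a ∈? S)
      ≡⟨ cong (count (λ S → independentIn? W S ×-dec ¬? (a ∈? S)) +_)
              (∑-flip a (indicator ∘ λ S → independentIn? W S ×-dec a ∈? S)) ⟩
    count (λ S → independentIn? W S ×-dec ¬? (a ∈? S))
      + count (λ S → independentIn? W (S [ a ]%= not) ×-dec a ∈? (S [ a ]%= not))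
      ≡⟨ cong₂ _+_ (count-cong _ (independentIn? (W - a)) independentIn-avoiding)
                   (count-cong _ (independentIn? (W ─ N[ a ])) (independentIn-containing a∈W)) ⟩
    #independent (W - a) + #independent (W ─ N[ a ]) ∎
    where open ≡-Reasoning

  #independent-isolated : a ∈ W → Isolated W a → 2 ∣ #independent W
  #independent-isolated {a = a} {W = W} a∈W isolated =
    subst (2 ∣_) (sym twice) (m∣m*n (#independent (W - a)))
    where
    twice : #independent W ≡ 2 * #independent (W - a)
    twice = trans (#independent-split a∈W)
                  (cong (λ X → #independent (W - a) + X) (trans (cong #independent (isolated⇒─N[]≡- isolated))
                                                                 (sym (+-identityʳ _))))

  #independent-pendant : a ∈ W → PendantAt W a b → 2 ∣ #independent (W - a)
  #independent-pendant {a = a} {W = W} {b = b} a∈W (b∈W , a~b , leaf) =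
    #independent-isolated (x∈p∧x≢y⇒x∈p-y b∈W b≢a) λ u u∈ b~u →
      proj₂ (∈-⁻ W u∈) (leaf (proj₁ (∈-⁻ W u∈)) b~u)
    where
    b≢a : b ≢ a
    b≢a refl = ~-irrefl a~b

  #independent-conical : IsPruning W A → ¬ NoIsolatedStep W A → 2 ∣ #independent W
  #independent-conical {A = []} _ ¬noIsolated = contradiction tt ¬noIsolated
  #independent-conical {W = W} {A = a ∷ A} (a∈W , step , pruning) ¬noIsolated with isolated? W a | step
  ... | yes isolated | _                  = #independent-isolated a∈W isolated
  ... | no ¬isolated | inj₁ isolated      = contradiction isolated ¬isolated
  ... | no ¬isolated | inj₂ (b , pendant) =
    subst (2 ∣_) (sym (#independent-split a∈W))
      (∣m∣n⇒∣m+n (#independent-pendant a∈W pendant)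
                 (#independent-conical pruning (¬noIsolated ∘ (¬isolated ,_))))

  #independent-spherical : IsPruning W A → NoIsolatedStep W A → Empty (pruned W A) → ¬ 2 ∣ #independent W
  #independent-spherical {A = []} _ _ empty 2∣ =
    contradiction (subst (2 ∣_) (#independent-empty empty) 2∣) λ { (divides (suc _) ()) ; (divides zero ()) }
  #independent-spherical {A = a ∷ A} (_ , inj₁ isolated , _) (¬isolated , _) _ =
    contradiction isolated ¬isolated
  #independent-spherical {A = a ∷ A} (a∈W , inj₂ (b , pendant) , pruning) (_ , noIsolated) empty 2∣ =
    #independent-spherical pruning noIsolated empty
      (∣m+n∣m⇒∣n (subst (2 ∣_) (#independent-split a∈W) 2∣) (#independent-pendant a∈W pendant))

  -- The parity of #independent full tells conical and spherical maximal resolutions apart.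
  maximal⇒noIsolatedStep : IsForest F → IsSpherical (edgeIdeal F) → IsMaximalResolution (edgeIdeal F) A →
                           NoIsolatedStep full A
  maximal⇒noIsolatedStep {A = A} forest (A' , maximal' , spherical') maximal =
    decidable-stable (noIsolatedStep? full A) λ ¬noIsolated →
      #independent-spherical pruning' (sphericalSeq⇒noIsolatedStep edgeIdeal≐edgeIdealOn-full pruning' spherical')
                             (proj₂ (maximal⇒prunedEmpty forest maximal'))
                             (#independent-conical (proj₁ (maximal⇒prunedEmpty forest maximal)) ¬noIsolated)
    where
    pruning' = proj₁ (maximal⇒prunedEmpty forest maximal')

proposition6p1 : ∀ {n} (F : Graph n) → IsForest F →
    IsSimple (edgeIdeal F)
    × (IsConical (edgeIdeal F) →
        Σ (Complex n) λ K → Collapses (R (edgeIdeal F)) K × IsPoint K)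
    × (∀ (d : ℕ) → IsMinDepth (edgeIdeal F) d → IsSpherical (edgeIdeal F) →
        Σ (Complex n) λ K → Collapses (R (edgeIdeal F)) K × IsCrossPolytopeBoundary K d)
proposition6p1 {n} F forest = simple , conical , spherical
  where
  Ḡ≐ = edgeIdeal≐edgeIdealOn-full F

  simple : IsSimple (edgeIdeal F)
  simple with complete-pruning F forest full
  ... | A , pruning , empty =
    A , prunedEmpty⇒maximal F pruning empty , ≐-trans (coreOf-≐ F Ḡ≐ pruning) (edgeIdealOn-empty F empty)

  conical : IsConical (edgeIdeal F) → Σ (Complex n) λ K → Collapses (R (edgeIdeal F)) K × IsPoint K
  conical (A , res , ¬spherical) = Collapses-respˡ IsPoint-resp (R-edgeIdeal≐Ind F)
    (collapse-conical F (crossJoin-start F) pruning (¬spherical ∘ noIsolatedStep⇒sphericalSeq F Ḡ≐ pruning))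
    where pruning = resolution⇒pruning F Ḡ≐ res

  spherical : ∀ d → IsMinDepth (edgeIdeal F) d → IsSpherical (edgeIdeal F) →
              Σ (Complex n) λ K → Collapses (R (edgeIdeal F)) K × IsCrossPolytopeBoundary K d
  spherical _ ((A , maximal , refl) , _) sph with maximal⇒prunedEmpty F forest maximal
  ... | pruning , empty = Collapses-respˡ IsCrossPolytopeBoundary-resp (R-edgeIdeal≐Ind F)
    (collapse-spherical F (crossJoin-start F) pruning (maximal⇒noIsolatedStep F forest sph maximal) empty)
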